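{- Let $M=x^2+x+1\in\mathbb{F}_2[x]$, $r\ge1$, $0\le j\le 2^{r-1}-1$, and $A=M^{2^r-j}$. Then $\ell_A=j+1$ if $j\neq0$, and $\ell_A=2^r+1$ if $j=0$.
   Context: For nonzero $A\in\mathbb{F}_2[x]$, the Collatz transformations are: $A_0=A$, and for $k\ge0$, $A_{2k+1}=A_{2k}/(x^{a_{2k}}(x+1)^{b_{2k}})$ where $a_{2k},b_{2k}$ are the multiplicities of $x$ and $x+1$ in $A_{2k}$, and $A_{2k+2}=1+MA_{2k+1}$. The length $\ell_A$ is $1+\min\{k\ge0: A_{2k+1}=1\}$, i.e. the number of terms of the sequence $A_1,A_3,A_5,\dots$ up to and including its first term equal to $1$. -}

module Defs where

open import Data.Bool using (Bool; true; false; if_then_else_; _xor_; not)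
open import Data.List using (List; []; _∷_; length)
open import Data.Nat using (ℕ; zero; suc; _<_)
open import Relation.Binary.PropositionalEquality using (_≡_)
open import Relation.Nullary using (¬_)
open import Data.Product using (_×_)
open import Data.Empty using (⊥)

-- Polynomials over F₂ as coefficient lists, lowest degree first,
-- kept in normal form (no trailing zero coefficients; [] is the zero polynomial).
Poly : Set
Poly = List Bool

norm : Poly → Poly
norm [] = []
norm (a ∷ p) with norm p
... | [] = if a then true ∷ [] else []
... | q@(_ ∷ _) = a ∷ q

addRaw : Poly → Poly → Poly
addRaw [] q = q
addRaw p [] = p
addRaw (a ∷ p) (b ∷ q) = (a xor b) ∷ addRaw p q

_+ᵖ_ : Poly → Poly → Poly
p +ᵖ q = norm (addRaw p q)

_*ᵖ_ : Poly → Poly → Poly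
[] *ᵖ q = []
(a ∷ p) *ᵖ q = (if a then q else []) +ᵖ norm (false ∷ (p *ᵖ q))

_^ᵖ_ : Poly → ℕ → Poly
p ^ᵖ zero = true ∷ []
p ^ᵖ suc n = p *ᵖ (p ^ᵖ n)

oneᵖ : Poly
oneᵖ = true ∷ []

M : Poly
M = true ∷ true ∷ true ∷ []

stripX : Poly → Poly
stripX [] = []
stripX (false ∷ p) = stripX p
stripX (true ∷ p) = true ∷ p

evalOne : Poly → Bool
evalOne [] = false
evalOne (a ∷ p) = a xor evalOne p

-- quotient of p by (x+1), assuming (x+1) ∣ p:  q_i = a_0 + … + a_i for i < deg p
divX1Aux : Bool → Poly → Poly
divX1Aux s [] = []
divX1Aux s (a ∷ []) = []
divX1Aux s (a ∷ p@(_ ∷ _)) = (s xor a) ∷ divX1Aux (s xor a) p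

divX1 : Poly → Poly
divX1 p = divX1Aux false p

-- divide out the full power of (x+1); fuel bounds the multiplicity
stripX1Fuel : ℕ → Poly → Poly
stripX1Fuel zero p = p
stripX1Fuel (suc f) [] = []
stripX1Fuel (suc f) p@(_ ∷ _) =
  if evalOne p then p else stripX1Fuel f (divX1 p)

stripX1 : Poly → Poly
stripX1 p = stripX1Fuel (length p) p

oddStep : Poly → Poly
oddStep A = stripX1 (stripX A)

evenStep : Poly → Poly
evenStep B = oneᵖ +ᵖ (M *ᵖ B)

-- oddTerm A k = A_{2k+1}
oddTerm : Poly → ℕ → Poly
oddTerm A zero = oddStep A
oddTerm A (suc k) = oddStep (evenStep (oddTerm A k))

-- ℓ_A = suc n  iff  A_{2n+1} = 1 and A_{2k+1} ≠ 1 for all k < n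
HasLength : Poly → ℕ → Set
HasLength A zero = ⊥
HasLength A (suc n) = (oddTerm A n ≡ oneᵖ) × (∀ k → k < n → ¬ (oddTerm A k ≡ oneᵖ))

{-# OPTIONS --safe #-}
-- Write S = X + 1 and φ p = p(X² + X), so that Mⁿ = φ(Sⁿ) and X² + X = X·S. When
-- B(0) = 1, φ B is prime to X·S and an odd Collatz step takes φ B to φ(T B), where
-- T B = (1 + S·B)/X^v removes every factor X. Hence the odd terms of Mⁿ are φ of the
-- T-orbit of Sⁿ, and it suffices to show, for Q a power of 2 and 1 ≤ m ≤ Q, that the
-- T-orbit of S^(2Q−m) reaches 1 at step m, from some B with S·B = 1 + X^f and f > Q;
-- since 1 is fixed, an earlier 1 would force M = 1 + (X² + X)^f, impossible for f ≥ 2.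
-- The induction on Q = 2P rests on S^P = 1 + X^P and on T ignoring perturbations
-- divisible by a high power of X. If m ≤ P, the orbit of S^(2Q−m) = S^(2P−m) + X^Q S^(2P−m)
-- shadows that of S^(2P−m). If m = P + m′, the orbit of S^(2P−m′) + X^P S^(2P−m′)
-- shadows that of S^(2P−m′) for m′ − 1 steps, then lands on X^P + S^(2P), from which
-- each of the next P − 1 steps divides by X exactly once before the final step to 1.

module Submission where

open import Defs
open import Data.Nat using (ℕ; zero; suc; _≤_; _<_; _+_; _∸_; _^_; s≤s; z≤n; z<s)
import Data.Nat.Properties as ℕ
open import Data.Nat.Solver using (module +-*-Solver)
open +-*-Solver using (solve; _:+_; _:=_; con)
open import Data.Nat.GeneralisedArithmetic using (iterate)
open import Relation.Binary.PropositionalEquality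
open import Relation.Nullary using (¬_; yes; no)
open import Data.Product using (_×_; _,_; proj₁; proj₂; ∃)
open import Data.Bool using (Bool; true; false; if_then_else_; _xor_; _∧_)
open import Data.Bool.Properties using (∧-comm; ∧-identityʳ; xor-comm; xor-assoc; xor-identityʳ; xor-same; ∧-distribʳ-xor)
open import Data.List using ([]; _∷_; length; replicate; _++_)
open import Level using (0ℓ)
open import Algebra.Core using (Op₂)
open import Algebra.Definitions using (Associative; Commutative)
open import Algebra.Bundles using (CommutativeSemigroup)
import Algebra.Properties.CommutativeSemigroup as CommutativeSemigroupProperties
open import Relation.Binary.PropositionalEquality.Algebra using (isMagma)

open ≡-Reasoning

≡-commutativeSemigroup : ∀ {A : Set} (_∙_ : Op₂ A) → Associative _≡_ _∙_ → Commutative _≡_ _∙_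
                       → CommutativeSemigroup 0ℓ 0ℓ
≡-commutativeSemigroup _∙_ assoc comm = record
  { isCommutativeSemigroup = record
    { isSemigroup = record { isMagma = isMagma _∙_ ; assoc = assoc }
    ; comm = comm
    }
  }

module xor = CommutativeSemigroupProperties (≡-commutativeSemigroup _xor_ xor-assoc xor-comm)

xor-cancelˡ : ∀ a b → a xor (a xor b) ≡ b
xor-cancelˡ a b = trans (sym (xor-assoc a a b)) (cong (_xor b) (xor-same a))

xor-true-false : ∀ a → a xor true ≡ false → a ≡ true
xor-true-false true _ = refl

-- Arithmetic of polynomials over F₂

coef : Poly → ℕ → Bool
coef [] n = false
coef (a ∷ p) zero = a
coef (a ∷ p) (suc n) = coef p n

data Normal : Poly → Set where
  nil  : Normal []
  one  : Normal (true ∷ [])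
  cons : ∀ a {b p} → Normal (b ∷ p) → Normal (a ∷ b ∷ p)

_⊲_ : Bool → Poly → Poly
a ⊲ [] = if a then true ∷ [] else []
a ⊲ (b ∷ q) = a ∷ b ∷ q

norm-∷ : ∀ a p → norm (a ∷ p) ≡ a ⊲ norm p
norm-∷ a p with norm p
... | [] = refl
... | _ ∷ _ = refl

⊲-Normal : ∀ a {p} → Normal p → Normal (a ⊲ p)
⊲-Normal true nil = one
⊲-Normal false nil = nil
⊲-Normal a one = cons a one
⊲-Normal a (cons b n) = cons a (cons b n)

norm-Normal : ∀ p → Normal (norm p)
norm-Normal [] = nil
norm-Normal (a ∷ p) rewrite norm-∷ a p = ⊲-Normal a (norm-Normal p)

norm-fixes-Normal : ∀ {p} → Normal p → norm p ≡ p
norm-fixes-Normal nil = refl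
norm-fixes-Normal one = refl
norm-fixes-Normal (cons a {b} {p} n) rewrite norm-∷ a (b ∷ p) | norm-fixes-Normal n = refl

Normal-tail : ∀ {a p} → Normal (a ∷ p) → Normal p
Normal-tail one = nil
Normal-tail (cons a n) = n

coef-⊲ : ∀ a p n → coef (a ⊲ p) n ≡ coef (a ∷ p) n
coef-⊲ true [] zero = refl
coef-⊲ true [] (suc n) = refl
coef-⊲ false [] zero = refl
coef-⊲ false [] (suc n) = refl
coef-⊲ a (b ∷ p) n = refl

coef-norm : ∀ p n → coef (norm p) n ≡ coef p n
coef-norm [] n = refl
coef-norm (a ∷ p) n rewrite norm-∷ a p = trans (coef-⊲ a (norm p) n) (coef-∷ n)
  where
  coef-∷ : ∀ n → coef (a ∷ norm p) n ≡ coef (a ∷ p) n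
  coef-∷ zero = refl
  coef-∷ (suc n) = coef-norm p n

coef-zero⇒[] : ∀ {p} → Normal p → (∀ n → coef p n ≡ false) → p ≡ []
coef-zero⇒[] nil z = refl
coef-zero⇒[] one z with z 0
... | ()
coef-zero⇒[] (cons a n) z with coef-zero⇒[] n (λ i → z (suc i))
... | ()

coef-injective : ∀ {p q} → Normal p → Normal q → (∀ n → coef p n ≡ coef q n) → p ≡ q
coef-injective {[]} np nq e = sym (coef-zero⇒[] nq (λ n → sym (e n)))
coef-injective {_ ∷ _} {[]} np nq e = coef-zero⇒[] np e
coef-injective {_ ∷ _} {_ ∷ _} np nq e =
  cong₂ _∷_ (e 0) (coef-injective (Normal-tail np) (Normal-tail nq) (λ n → e (suc n)))

coef-addRaw : ∀ p q n → coef (addRaw p q) n ≡ coef p n xor coef q n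
coef-addRaw [] q n = refl
coef-addRaw (a ∷ p) [] n = sym (xor-identityʳ (coef (a ∷ p) n))
coef-addRaw (a ∷ p) (b ∷ q) zero = refl
coef-addRaw (a ∷ p) (b ∷ q) (suc n) = coef-addRaw p q n

coef-+ᵖ : ∀ p q n → coef (p +ᵖ q) n ≡ coef p n xor coef q n
coef-+ᵖ p q n = trans (coef-norm (addRaw p q) n) (coef-addRaw p q n)

+ᵖ-Normal : ∀ p q → Normal (p +ᵖ q)
+ᵖ-Normal p q = norm-Normal (addRaw p q)

+ᵖ-comm : ∀ p q → p +ᵖ q ≡ q +ᵖ p
+ᵖ-comm p q = coef-injective (+ᵖ-Normal p q) (+ᵖ-Normal q p) λ n → begin
  coef (p +ᵖ q) n         ≡⟨ coef-+ᵖ p q n ⟩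
  coef p n xor coef q n   ≡⟨ xor-comm (coef p n) (coef q n) ⟩
  coef q n xor coef p n   ≡⟨ coef-+ᵖ q p n ⟨
  coef (q +ᵖ p) n         ∎

+ᵖ-assoc : ∀ p q r → (p +ᵖ q) +ᵖ r ≡ p +ᵖ (q +ᵖ r)
+ᵖ-assoc p q r = coef-injective (+ᵖ-Normal (p +ᵖ q) r) (+ᵖ-Normal p (q +ᵖ r)) λ n → begin
  coef ((p +ᵖ q) +ᵖ r) n                   ≡⟨ coef-+ᵖ (p +ᵖ q) r n ⟩
  coef (p +ᵖ q) n xor coef r n             ≡⟨ cong (_xor coef r n) (coef-+ᵖ p q n) ⟩
  (coef p n xor coef q n) xor coef r n     ≡⟨ xor-assoc (coef p n) (coef q n) (coef r n) ⟩
  coef p n xor (coef q n xor coef r n)     ≡⟨ cong (coef p n xor_) (coef-+ᵖ q r n) ⟨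
  coef p n xor coef (q +ᵖ r) n             ≡⟨ coef-+ᵖ p (q +ᵖ r) n ⟨
  coef (p +ᵖ (q +ᵖ r)) n                   ∎

module +ᵖ = CommutativeSemigroupProperties (≡-commutativeSemigroup _+ᵖ_ +ᵖ-assoc +ᵖ-comm)

+ᵖ-identityˡ : ∀ {p} → Normal p → [] +ᵖ p ≡ p
+ᵖ-identityˡ np = norm-fixes-Normal np

+ᵖ-identityʳ : ∀ {p} → Normal p → p +ᵖ [] ≡ p
+ᵖ-identityʳ {p} np = trans (+ᵖ-comm p []) (+ᵖ-identityˡ np)

+ᵖ-self : ∀ p → p +ᵖ p ≡ []
+ᵖ-self p = coef-injective (+ᵖ-Normal p p) nil λ n → trans (coef-+ᵖ p p n) (xor-same (coef p n))

+ᵖ-normˡ : ∀ p q → norm p +ᵖ q ≡ p +ᵖ q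
+ᵖ-normˡ p q = coef-injective (+ᵖ-Normal (norm p) q) (+ᵖ-Normal p q) λ n →
  trans (coef-+ᵖ (norm p) q n) (trans (cong (_xor coef q n) (coef-norm p n)) (sym (coef-+ᵖ p q n)))

+ᵖ-moveʳ : ∀ {p} q r → Normal p → p +ᵖ q ≡ r → p ≡ r +ᵖ q
+ᵖ-moveʳ {p} q r np e = begin
  p                  ≡⟨ +ᵖ-identityʳ np ⟨
  p +ᵖ []            ≡⟨ cong (p +ᵖ_) (+ᵖ-self q) ⟨
  p +ᵖ (q +ᵖ q)      ≡⟨ +ᵖ-assoc p q q ⟨
  (p +ᵖ q) +ᵖ q      ≡⟨ cong (_+ᵖ q) e ⟩
  r +ᵖ q             ∎

+ᵖ-cancel-middle : ∀ p q {r} → Normal r → (p +ᵖ q) +ᵖ (q +ᵖ r) ≡ p +ᵖ r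
+ᵖ-cancel-middle p q {r} nr = begin
  (p +ᵖ q) +ᵖ (q +ᵖ r)    ≡⟨ +ᵖ-assoc p q (q +ᵖ r) ⟩
  p +ᵖ (q +ᵖ (q +ᵖ r))    ≡⟨ cong (p +ᵖ_) (+ᵖ-assoc q q r) ⟨
  p +ᵖ ((q +ᵖ q) +ᵖ r)    ≡⟨ cong (λ z → p +ᵖ (z +ᵖ r)) (+ᵖ-self q) ⟩
  p +ᵖ ([] +ᵖ r)          ≡⟨ cong (p +ᵖ_) (+ᵖ-identityˡ nr) ⟩
  p +ᵖ r                  ∎

scale : Bool → Poly → Poly
scale a q = if a then q else []

shift : Poly → Poly
shift p = norm (false ∷ p)

coef-scale : ∀ a q n → coef (scale a q) n ≡ a ∧ coef q n
coef-scale true q n = refl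
coef-scale false q n = refl

coef-shift-zero : ∀ p → coef (shift p) 0 ≡ false
coef-shift-zero p = coef-norm (false ∷ p) 0

coef-shift-suc : ∀ p n → coef (shift p) (suc n) ≡ coef p n
coef-shift-suc p n = coef-norm (false ∷ p) (suc n)

*ᵖ-Normal : ∀ p q → Normal (p *ᵖ q)
*ᵖ-Normal [] q = nil
*ᵖ-Normal (a ∷ p) q = +ᵖ-Normal (scale a q) (shift (p *ᵖ q))

*ᵖ-⊲ : ∀ a p q → (a ⊲ p) *ᵖ q ≡ scale a q +ᵖ shift (p *ᵖ q)
*ᵖ-⊲ true [] q = refl
*ᵖ-⊲ false [] q = refl
*ᵖ-⊲ a (b ∷ p) q = refl

*ᵖ-normˡ : ∀ p q → norm p *ᵖ q ≡ p *ᵖ q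
*ᵖ-normˡ [] q = refl
*ᵖ-normˡ (a ∷ p) q rewrite norm-∷ a p =
  trans (*ᵖ-⊲ a (norm p) q) (cong (λ z → scale a q +ᵖ shift z) (*ᵖ-normˡ p q))

*ᵖ-normʳ : ∀ p q → p *ᵖ norm q ≡ p *ᵖ q
*ᵖ-normʳ [] q = refl
*ᵖ-normʳ (a ∷ p) q = trans (cong (λ z → scale a (norm q) +ᵖ shift z) (*ᵖ-normʳ p q)) (scale-norm a)
  where
  scale-norm : ∀ a → scale a (norm q) +ᵖ shift (p *ᵖ q) ≡ scale a q +ᵖ shift (p *ᵖ q)
  scale-norm true = +ᵖ-normˡ q (shift (p *ᵖ q))
  scale-norm false = refl

*ᵖ-zeroʳ : ∀ p → p *ᵖ [] ≡ []
*ᵖ-zeroʳ [] = refl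
*ᵖ-zeroʳ (false ∷ p) rewrite *ᵖ-zeroʳ p = refl
*ᵖ-zeroʳ (true ∷ p) rewrite *ᵖ-zeroʳ p = refl

shift-+ᵖ : ∀ p q → shift (p +ᵖ q) ≡ shift p +ᵖ shift q
shift-+ᵖ p q = coef-injective (norm-Normal (false ∷ (p +ᵖ q))) (+ᵖ-Normal (shift p) (shift q)) coefs
  where
  coefs : ∀ n → coef (shift (p +ᵖ q)) n ≡ coef (shift p +ᵖ shift q) n
  coefs zero rewrite coef-+ᵖ (shift p) (shift q) 0 | coef-shift-zero (p +ᵖ q)
                   | coef-shift-zero p | coef-shift-zero q = refl
  coefs (suc n) rewrite coef-+ᵖ (shift p) (shift q) (suc n) | coef-shift-suc (p +ᵖ q) n
                      | coef-shift-suc p n | coef-shift-suc q n = coef-+ᵖ p q n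

scale-xor : ∀ a b {r} → Normal r → scale (a xor b) r ≡ scale a r +ᵖ scale b r
scale-xor true true {r} nr = sym (+ᵖ-self r)
scale-xor true false nr = sym (+ᵖ-identityʳ nr)
scale-xor false true nr = sym (+ᵖ-identityˡ nr)
scale-xor false false nr = refl

*ᵖ-distribʳ-addRaw : ∀ p q {r} → Normal r → addRaw p q *ᵖ r ≡ (p *ᵖ r) +ᵖ (q *ᵖ r)
*ᵖ-distribʳ-addRaw [] q nr = sym (+ᵖ-identityˡ (*ᵖ-Normal q _))
*ᵖ-distribʳ-addRaw (a ∷ p) [] nr = sym (+ᵖ-identityʳ (*ᵖ-Normal (a ∷ p) _))
*ᵖ-distribʳ-addRaw (a ∷ p) (b ∷ q) {r} nr = begin
  scale (a xor b) r +ᵖ shift (addRaw p q *ᵖ r)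
    ≡⟨ cong₂ _+ᵖ_ (scale-xor a b nr) (cong shift (*ᵖ-distribʳ-addRaw p q nr)) ⟩
  (scale a r +ᵖ scale b r) +ᵖ shift ((p *ᵖ r) +ᵖ (q *ᵖ r))
    ≡⟨ cong ((scale a r +ᵖ scale b r) +ᵖ_) (shift-+ᵖ (p *ᵖ r) (q *ᵖ r)) ⟩
  (scale a r +ᵖ scale b r) +ᵖ (shift (p *ᵖ r) +ᵖ shift (q *ᵖ r))
    ≡⟨ +ᵖ.interchange (scale a r) (scale b r) _ _ ⟩
  ((a ∷ p) *ᵖ r) +ᵖ ((b ∷ q) *ᵖ r) ∎

*ᵖ-distribʳ-+ᵖ : ∀ p q r → (p +ᵖ q) *ᵖ r ≡ (p *ᵖ r) +ᵖ (q *ᵖ r)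
*ᵖ-distribʳ-+ᵖ p q r = begin
  (p +ᵖ q) *ᵖ r                 ≡⟨ *ᵖ-normʳ (p +ᵖ q) r ⟨
  norm (addRaw p q) *ᵖ norm r   ≡⟨ *ᵖ-normˡ (addRaw p q) (norm r) ⟩
  addRaw p q *ᵖ norm r          ≡⟨ *ᵖ-distribʳ-addRaw p q (norm-Normal r) ⟩
  (p *ᵖ norm r) +ᵖ (q *ᵖ norm r)   ≡⟨ cong₂ _+ᵖ_ (*ᵖ-normʳ p r) (*ᵖ-normʳ q r) ⟩
  (p *ᵖ r) +ᵖ (q *ᵖ r)          ∎

*ᵖ-consʳ : ∀ p b q → p *ᵖ (b ∷ q) ≡ scale b p +ᵖ shift (p *ᵖ q)
*ᵖ-consʳ [] true q = refl
*ᵖ-consʳ [] false q = refl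
*ᵖ-consʳ (a ∷ p) b q = trans (cong (λ z → scale a (b ∷ q) +ᵖ shift z) (*ᵖ-consʳ p b q))
  (coef-injective (+ᵖ-Normal (scale a (b ∷ q)) _) (+ᵖ-Normal (scale b (a ∷ p)) _) coefs)
  where
  W = shift (p *ᵖ q)
  coefs : ∀ n → coef (scale a (b ∷ q) +ᵖ shift (scale b p +ᵖ W)) n
              ≡ coef (scale b (a ∷ p) +ᵖ shift (scale a q +ᵖ W)) n
  coefs zero
    rewrite coef-+ᵖ (scale a (b ∷ q)) (shift (scale b p +ᵖ W)) 0
          | coef-+ᵖ (scale b (a ∷ p)) (shift (scale a q +ᵖ W)) 0
          | coef-shift-zero (scale b p +ᵖ W) | coef-shift-zero (scale a q +ᵖ W)
          | coef-scale a (b ∷ q) 0 | coef-scale b (a ∷ p) 0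
          = cong (_xor false) (∧-comm a b)
  coefs (suc n)
    rewrite coef-+ᵖ (scale a (b ∷ q)) (shift (scale b p +ᵖ W)) (suc n)
          | coef-+ᵖ (scale b (a ∷ p)) (shift (scale a q +ᵖ W)) (suc n)
          | coef-shift-suc (scale b p +ᵖ W) n | coef-shift-suc (scale a q +ᵖ W) n
          | coef-+ᵖ (scale b p) W n | coef-+ᵖ (scale a q) W n
          | coef-scale a (b ∷ q) (suc n) | coef-scale b (a ∷ p) (suc n)
          | coef-scale b p n | coef-scale a q n
          = xor.x∙yz≈y∙xz (a ∧ coef q n) (b ∧ coef p n) (coef W n)

*ᵖ-comm : ∀ p q → p *ᵖ q ≡ q *ᵖ p
*ᵖ-comm [] q = sym (*ᵖ-zeroʳ q)
*ᵖ-comm (a ∷ p) q = trans (cong (λ z → scale a q +ᵖ shift z) (*ᵖ-comm p q)) (sym (*ᵖ-consʳ q a p))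

shift-*ᵖ : ∀ p q → shift p *ᵖ q ≡ shift (p *ᵖ q)
shift-*ᵖ p q = trans (*ᵖ-normˡ (false ∷ p) q) (+ᵖ-identityˡ (norm-Normal (false ∷ (p *ᵖ q))))

*ᵖ-assoc : ∀ p q r → (p *ᵖ q) *ᵖ r ≡ p *ᵖ (q *ᵖ r)
*ᵖ-assoc [] q r = refl
*ᵖ-assoc (a ∷ p) q r = begin
  (scale a q +ᵖ shift (p *ᵖ q)) *ᵖ r
    ≡⟨ *ᵖ-distribʳ-+ᵖ (scale a q) (shift (p *ᵖ q)) r ⟩
  (scale a q *ᵖ r) +ᵖ (shift (p *ᵖ q) *ᵖ r)
    ≡⟨ cong₂ _+ᵖ_ (scale-* a) (shift-*ᵖ (p *ᵖ q) r) ⟩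
  scale a (q *ᵖ r) +ᵖ shift ((p *ᵖ q) *ᵖ r)
    ≡⟨ cong (λ z → scale a (q *ᵖ r) +ᵖ shift z) (*ᵖ-assoc p q r) ⟩
  scale a (q *ᵖ r) +ᵖ shift (p *ᵖ (q *ᵖ r)) ∎
  where
  scale-* : ∀ a → scale a q *ᵖ r ≡ scale a (q *ᵖ r)
  scale-* true = refl
  scale-* false = refl

oneᵖ*ᵖ≡norm : ∀ p → oneᵖ *ᵖ p ≡ norm p
oneᵖ*ᵖ≡norm [] = refl
oneᵖ*ᵖ≡norm (a ∷ p) = refl

*ᵖ-identityˡ : ∀ {p} → Normal p → oneᵖ *ᵖ p ≡ p
*ᵖ-identityˡ np = +ᵖ-identityʳ np

*ᵖ-identityʳ : ∀ {p} → Normal p → p *ᵖ oneᵖ ≡ p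
*ᵖ-identityʳ {p} np = trans (*ᵖ-comm p oneᵖ) (*ᵖ-identityˡ np)

*ᵖ-distribˡ-+ᵖ : ∀ p q r → p *ᵖ (q +ᵖ r) ≡ (p *ᵖ q) +ᵖ (p *ᵖ r)
*ᵖ-distribˡ-+ᵖ p q r = trans (*ᵖ-comm p (q +ᵖ r))
  (trans (*ᵖ-distribʳ-+ᵖ q r p) (cong₂ _+ᵖ_ (*ᵖ-comm q p) (*ᵖ-comm r p)))

module *ᵖ = CommutativeSemigroupProperties (≡-commutativeSemigroup _*ᵖ_ *ᵖ-assoc *ᵖ-comm)

*ᵖ-lcomm : ∀ p q r → p *ᵖ (q *ᵖ r) ≡ q *ᵖ (p *ᵖ r)
*ᵖ-lcomm = *ᵖ.x∙yz≈y∙xz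

1+[1+p]≡p : ∀ {p} → Normal p → oneᵖ +ᵖ (oneᵖ +ᵖ p) ≡ p
1+[1+p]≡p {p} np = trans (sym (+ᵖ-assoc oneᵖ oneᵖ p)) (+ᵖ-identityˡ np)

[1+p]+p[1+q]≡1+pq : ∀ {p} q → Normal p → (oneᵖ +ᵖ p) +ᵖ (p *ᵖ (oneᵖ +ᵖ q)) ≡ oneᵖ +ᵖ (p *ᵖ q)
[1+p]+p[1+q]≡1+pq {p} q np = begin
  (oneᵖ +ᵖ p) +ᵖ (p *ᵖ (oneᵖ +ᵖ q))      ≡⟨ cong ((oneᵖ +ᵖ p) +ᵖ_) (*ᵖ-distribˡ-+ᵖ p oneᵖ q) ⟩
  (oneᵖ +ᵖ p) +ᵖ ((p *ᵖ oneᵖ) +ᵖ (p *ᵖ q)) ≡⟨ cong (λ c → (oneᵖ +ᵖ p) +ᵖ (c +ᵖ (p *ᵖ q))) (*ᵖ-identityʳ np) ⟩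
  (oneᵖ +ᵖ p) +ᵖ (p +ᵖ (p *ᵖ q))          ≡⟨ +ᵖ-cancel-middle oneᵖ p (*ᵖ-Normal p q) ⟩
  oneᵖ +ᵖ (p *ᵖ q)                        ∎

^ᵖ-Normal : ∀ p n → Normal (p ^ᵖ n)
^ᵖ-Normal p zero = one
^ᵖ-Normal p (suc n) = *ᵖ-Normal p (p ^ᵖ n)

^ᵖ-+ : ∀ p m n → p ^ᵖ (m + n) ≡ (p ^ᵖ m) *ᵖ (p ^ᵖ n)
^ᵖ-+ p zero n = sym (*ᵖ-identityˡ (^ᵖ-Normal p n))
^ᵖ-+ p (suc m) n = trans (cong (p *ᵖ_) (^ᵖ-+ p m n)) (sym (*ᵖ-assoc p (p ^ᵖ m) (p ^ᵖ n)))

*ᵖ-^ : ∀ p q n → (p *ᵖ q) ^ᵖ n ≡ (p ^ᵖ n) *ᵖ (q ^ᵖ n)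
*ᵖ-^ p q zero = refl
*ᵖ-^ p q (suc n) = begin
  (p *ᵖ q) *ᵖ ((p *ᵖ q) ^ᵖ n)  ≡⟨ cong ((p *ᵖ q) *ᵖ_) (*ᵖ-^ p q n) ⟩
  (p *ᵖ q) *ᵖ (P *ᵖ Q)         ≡⟨ *ᵖ-assoc p q (P *ᵖ Q) ⟩
  p *ᵖ (q *ᵖ (P *ᵖ Q))         ≡⟨ cong (p *ᵖ_) (*ᵖ-lcomm q P Q) ⟩
  p *ᵖ (P *ᵖ (q *ᵖ Q))         ≡⟨ *ᵖ-assoc p P (q *ᵖ Q) ⟨
  (p *ᵖ P) *ᵖ (q *ᵖ Q)         ∎
  where
  P = p ^ᵖ n
  Q = q ^ᵖ n

square-+ᵖ : ∀ p q → (p +ᵖ q) *ᵖ (p +ᵖ q) ≡ (p *ᵖ p) +ᵖ (q *ᵖ q)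
square-+ᵖ p q = begin
  (p +ᵖ q) *ᵖ (p +ᵖ q)                            ≡⟨ *ᵖ-distribʳ-+ᵖ p q (p +ᵖ q) ⟩
  (p *ᵖ (p +ᵖ q)) +ᵖ (q *ᵖ (p +ᵖ q))              ≡⟨ cong₂ _+ᵖ_ (*ᵖ-distribˡ-+ᵖ p p q) (*ᵖ-distribˡ-+ᵖ q p q) ⟩
  ((p *ᵖ p) +ᵖ (p *ᵖ q)) +ᵖ ((q *ᵖ p) +ᵖ (q *ᵖ q)) ≡⟨ cong (λ z → ((p *ᵖ p) +ᵖ (p *ᵖ q)) +ᵖ (z +ᵖ (q *ᵖ q))) (*ᵖ-comm q p) ⟩
  ((p *ᵖ p) +ᵖ (p *ᵖ q)) +ᵖ ((p *ᵖ q) +ᵖ (q *ᵖ q)) ≡⟨ +ᵖ-cancel-middle (p *ᵖ p) (p *ᵖ q) (*ᵖ-Normal q q) ⟩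
  (p *ᵖ p) +ᵖ (q *ᵖ q) ∎

data IsPow2 : ℕ → Set where
  two^zero : IsPow2 1
  two^suc  : ∀ {Q} → IsPow2 Q → IsPow2 (Q + Q)

frobenius : ∀ {Q} → IsPow2 Q → ∀ p q → (p +ᵖ q) ^ᵖ Q ≡ (p ^ᵖ Q) +ᵖ (q ^ᵖ Q)
frobenius two^zero p q = *ᵖ-distribʳ-+ᵖ p q oneᵖ
frobenius (two^suc {Q} pow) p q = begin
  (p +ᵖ q) ^ᵖ (Q + Q)                         ≡⟨ ^ᵖ-+ (p +ᵖ q) Q Q ⟩
  ((p +ᵖ q) ^ᵖ Q) *ᵖ ((p +ᵖ q) ^ᵖ Q)          ≡⟨ cong₂ _*ᵖ_ (frobenius pow p q) (frobenius pow p q) ⟩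
  ((p ^ᵖ Q) +ᵖ (q ^ᵖ Q)) *ᵖ ((p ^ᵖ Q) +ᵖ (q ^ᵖ Q)) ≡⟨ square-+ᵖ (p ^ᵖ Q) (q ^ᵖ Q) ⟩
  ((p ^ᵖ Q) *ᵖ (p ^ᵖ Q)) +ᵖ ((q ^ᵖ Q) *ᵖ (q ^ᵖ Q)) ≡⟨ cong₂ _+ᵖ_ (^ᵖ-+ p Q Q) (^ᵖ-+ q Q Q) ⟨
  (p ^ᵖ (Q + Q)) +ᵖ (q ^ᵖ (Q + Q))            ∎

eval₀ : Poly → Bool
eval₀ p = coef p 0

eval₀-+ᵖ : ∀ p q → eval₀ (p +ᵖ q) ≡ eval₀ p xor eval₀ q
eval₀-+ᵖ p q = coef-+ᵖ p q 0

eval₀-*ᵖ : ∀ p q → eval₀ (p *ᵖ q) ≡ eval₀ p ∧ eval₀ q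
eval₀-*ᵖ [] q = refl
eval₀-*ᵖ (a ∷ p) q = begin
  eval₀ (scale a q +ᵖ shift (p *ᵖ q))  ≡⟨ coef-+ᵖ (scale a q) (shift (p *ᵖ q)) 0 ⟩
  coef (scale a q) 0 xor coef (shift (p *ᵖ q)) 0 ≡⟨ cong₂ _xor_ (coef-scale a q 0) (coef-shift-zero (p *ᵖ q)) ⟩
  (a ∧ eval₀ q) xor false              ≡⟨ xor-identityʳ (a ∧ eval₀ q) ⟩
  a ∧ eval₀ q                          ∎

evalOne-⊲ : ∀ a p → evalOne (a ⊲ p) ≡ a xor evalOne p
evalOne-⊲ true [] = refl
evalOne-⊲ false [] = refl
evalOne-⊲ a (b ∷ p) = refl

evalOne-norm : ∀ p → evalOne (norm p) ≡ evalOne p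
evalOne-norm [] = refl
evalOne-norm (a ∷ p) rewrite norm-∷ a p = trans (evalOne-⊲ a (norm p)) (cong (a xor_) (evalOne-norm p))

evalOne-addRaw : ∀ p q → evalOne (addRaw p q) ≡ evalOne p xor evalOne q
evalOne-addRaw [] q = refl
evalOne-addRaw (a ∷ p) [] = sym (xor-identityʳ (evalOne (a ∷ p)))
evalOne-addRaw (a ∷ p) (b ∷ q) = begin
  (a xor b) xor evalOne (addRaw p q)             ≡⟨ cong ((a xor b) xor_) (evalOne-addRaw p q) ⟩
  (a xor b) xor (evalOne p xor evalOne q)        ≡⟨ xor.interchange a b (evalOne p) (evalOne q) ⟩
  (a xor evalOne p) xor (b xor evalOne q)        ∎

evalOne-+ᵖ : ∀ p q → evalOne (p +ᵖ q) ≡ evalOne p xor evalOne q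
evalOne-+ᵖ p q = trans (evalOne-norm (addRaw p q)) (evalOne-addRaw p q)

evalOne-*ᵖ : ∀ p q → evalOne (p *ᵖ q) ≡ evalOne p ∧ evalOne q
evalOne-*ᵖ [] q = refl
evalOne-*ᵖ (a ∷ p) q = begin
  evalOne (scale a q +ᵖ shift (p *ᵖ q))            ≡⟨ evalOne-+ᵖ (scale a q) (shift (p *ᵖ q)) ⟩
  evalOne (scale a q) xor evalOne (shift (p *ᵖ q)) ≡⟨ cong₂ _xor_ (evalOne-scale a) (evalOne-norm (false ∷ (p *ᵖ q))) ⟩
  (a ∧ evalOne q) xor evalOne (p *ᵖ q)            ≡⟨ cong ((a ∧ evalOne q) xor_) (evalOne-*ᵖ p q) ⟩
  (a ∧ evalOne q) xor (evalOne p ∧ evalOne q)     ≡⟨ ∧-distribʳ-xor (evalOne q) a (evalOne p) ⟨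
  (a xor evalOne p) ∧ evalOne q                   ∎
  where
  evalOne-scale : ∀ a → evalOne (scale a q) ≡ a ∧ evalOne q
  evalOne-scale true = refl
  evalOne-scale false = refl

X : Poly
X = false ∷ true ∷ []

X+1 : Poly
X+1 = true ∷ true ∷ []

X-Normal : Normal X
X-Normal = cons false one

X+1-Normal : Normal X+1
X+1-Normal = cons true one

X*-∷ : ∀ {b p} → Normal (b ∷ p) → X *ᵖ (b ∷ p) ≡ false ∷ b ∷ p
X*-∷ {b} {p} n = begin
  [] +ᵖ shift (oneᵖ *ᵖ (b ∷ p))  ≡⟨ +ᵖ-identityˡ (norm-Normal (false ∷ (oneᵖ *ᵖ (b ∷ p)))) ⟩
  shift (oneᵖ *ᵖ (b ∷ p))        ≡⟨ cong shift (*ᵖ-identityˡ n) ⟩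
  norm (false ∷ b ∷ p)           ≡⟨ norm-fixes-Normal (cons false n) ⟩
  false ∷ b ∷ p                  ∎

X^*-true∷ : ∀ e {q} → Normal (true ∷ q) → (X ^ᵖ e) *ᵖ (true ∷ q) ≡ replicate e false ++ (true ∷ q)
X^*-true∷ zero n = *ᵖ-identityˡ n
X^*-true∷ (suc e) {q} n = begin
  (X *ᵖ (X ^ᵖ e)) *ᵖ (true ∷ q)         ≡⟨ *ᵖ-assoc X (X ^ᵖ e) (true ∷ q) ⟩
  X *ᵖ ((X ^ᵖ e) *ᵖ (true ∷ q))         ≡⟨ cong (X *ᵖ_) (X^*-true∷ e n) ⟩
  X *ᵖ (replicate e false ++ (true ∷ q)) ≡⟨ X*-padded e ⟩
  false ∷ replicate e false ++ (true ∷ q) ∎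
  where
  padded : ∀ e → Normal (false ∷ replicate e false ++ (true ∷ q))
  padded zero = cons false n
  padded (suc e) = cons false (padded e)
  X*-padded : ∀ e → X *ᵖ (replicate e false ++ (true ∷ q)) ≡ false ∷ replicate e false ++ (true ∷ q)
  X*-padded zero = X*-∷ n
  X*-padded (suc e) = X*-∷ (padded e)

ordX : Poly → ℕ
ordX [] = 0
ordX (false ∷ p) = suc (ordX p)
ordX (true ∷ p) = 0

stripX-padded : ∀ e q → stripX (replicate e false ++ (true ∷ q)) ≡ true ∷ q
stripX-padded zero q = refl
stripX-padded (suc e) q = stripX-padded e q

ordX-padded : ∀ e q → ordX (replicate e false ++ (true ∷ q)) ≡ e
ordX-padded zero q = refl
ordX-padded (suc e) q = cong suc (ordX-padded e q)

stripX-X^* : ∀ e {q} → Normal q → eval₀ q ≡ true → stripX ((X ^ᵖ e) *ᵖ q) ≡ q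
stripX-X^* e {true ∷ q} n _ = trans (cong stripX (X^*-true∷ e n)) (stripX-padded e q)

ordX-X^* : ∀ e {q} → Normal q → eval₀ q ≡ true → ordX ((X ^ᵖ e) *ᵖ q) ≡ e
ordX-X^* e {true ∷ q} n _ = trans (cong ordX (X^*-true∷ e n)) (ordX-padded e q)

X^ordX*stripX : ∀ {p} → Normal p → (X ^ᵖ ordX p) *ᵖ stripX p ≡ p
X^ordX*stripX nil = refl
X^ordX*stripX one = refl
X^ordX*stripX (cons false {b} {p} n) = begin
  (X *ᵖ (X ^ᵖ ordX (b ∷ p))) *ᵖ stripX (b ∷ p)  ≡⟨ *ᵖ-assoc X (X ^ᵖ ordX (b ∷ p)) (stripX (b ∷ p)) ⟩
  X *ᵖ ((X ^ᵖ ordX (b ∷ p)) *ᵖ stripX (b ∷ p))  ≡⟨ cong (X *ᵖ_) (X^ordX*stripX n) ⟩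
  X *ᵖ (b ∷ p)                                   ≡⟨ X*-∷ n ⟩
  false ∷ b ∷ p                                  ∎
X^ordX*stripX (cons true n) = *ᵖ-identityˡ (cons true n)

eval₀-stripX : ∀ p → evalOne p ≡ true → eval₀ (stripX p) ≡ true
eval₀-stripX (false ∷ p) e = eval₀-stripX p e
eval₀-stripX (true ∷ p) e = refl

X*-cancel : ∀ {p q} → Normal p → Normal q → X *ᵖ p ≡ X *ᵖ q → p ≡ q
X*-cancel {p} {q} np nq e = coef-injective np nq λ n → begin
  coef p n                  ≡⟨ coef-X* np n ⟨
  coef (X *ᵖ p) (suc n)     ≡⟨ cong (λ r → coef r (suc n)) e ⟩
  coef (X *ᵖ q) (suc n)     ≡⟨ coef-X* nq n ⟩
  coef q n                  ∎
  where
  coef-X* : ∀ {r} → Normal r → ∀ n → coef (X *ᵖ r) (suc n) ≡ coef r n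
  coef-X* nil n = refl
  coef-X* one n = cong (λ s → coef s (suc n)) (X*-∷ one)
  coef-X* (cons a m) n = cong (λ s → coef s (suc n)) (X*-∷ (cons a m))

X-divides : ∀ {p} → Normal p → eval₀ p ≡ false → ∃ λ q → Normal q × p ≡ X *ᵖ q
X-divides nil _ = [] , nil , refl
X-divides (cons false n) _ = _ , n , sym (X*-∷ n)

X+1*-+X^* : ∀ U a V → X+1 *ᵖ (U +ᵖ ((X ^ᵖ a) *ᵖ V)) ≡ (X+1 *ᵖ U) +ᵖ ((X ^ᵖ a) *ᵖ (X+1 *ᵖ V))
X+1*-+X^* U a V = trans (*ᵖ-distribˡ-+ᵖ X+1 U _) (cong ((X+1 *ᵖ U) +ᵖ_) (*ᵖ-lcomm X+1 (X ^ᵖ a) V))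

X^+* : ∀ a b V → (X ^ᵖ a) *ᵖ ((X ^ᵖ b) *ᵖ V) ≡ (X ^ᵖ (a + b)) *ᵖ V
X^+* a b V = trans (sym (*ᵖ-assoc (X ^ᵖ a) (X ^ᵖ b) V)) (cong (_*ᵖ V) (sym (^ᵖ-+ X a b)))

eval₀-X^suc : ∀ t → eval₀ (X ^ᵖ suc t) ≡ false
eval₀-X^suc t = eval₀-*ᵖ X (X ^ᵖ t)

eval₀-X^suc* : ∀ t V → eval₀ ((X ^ᵖ suc t) *ᵖ V) ≡ false
eval₀-X^suc* t V = trans (eval₀-*ᵖ (X ^ᵖ suc t) V) (cong (_∧ eval₀ V) (eval₀-X^suc t))

^ᵖ-one : ∀ n → oneᵖ ^ᵖ n ≡ oneᵖ
^ᵖ-one zero = refl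
^ᵖ-one (suc n) rewrite ^ᵖ-one n = refl

IsPow2-positive : ∀ {Q} → IsPow2 Q → 0 < Q
IsPow2-positive two^zero = z<s
IsPow2-positive (two^suc {Q} pow) = ℕ.<-≤-trans (IsPow2-positive pow) (ℕ.m≤m+n Q Q)

IsPow2-2^ : ∀ b → IsPow2 (2 ^ b)
IsPow2-2^ zero = two^zero
IsPow2-2^ (suc b) = subst IsPow2 (cong (2 ^ b +_) (sym (ℕ.+-identityʳ (2 ^ b)))) (two^suc (IsPow2-2^ b))

X+1^-IsPow2 : ∀ {Q} → IsPow2 Q → X+1 ^ᵖ Q ≡ oneᵖ +ᵖ (X ^ᵖ Q)
X+1^-IsPow2 {Q} pow = trans (frobenius pow oneᵖ X) (cong (_+ᵖ (X ^ᵖ Q)) (^ᵖ-one Q))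

X+1^+IsPow2 : ∀ {Q} → IsPow2 Q → ∀ n → X+1 ^ᵖ (n + Q) ≡ (X+1 ^ᵖ n) +ᵖ ((X ^ᵖ Q) *ᵖ (X+1 ^ᵖ n))
X+1^+IsPow2 {Q} pow n = begin
  X+1 ^ᵖ (n + Q)                      ≡⟨ ^ᵖ-+ X+1 n Q ⟩
  R *ᵖ (X+1 ^ᵖ Q)                     ≡⟨ cong (R *ᵖ_) (X+1^-IsPow2 pow) ⟩
  R *ᵖ (oneᵖ +ᵖ (X ^ᵖ Q))             ≡⟨ *ᵖ-distribˡ-+ᵖ R oneᵖ (X ^ᵖ Q) ⟩
  (R *ᵖ oneᵖ) +ᵖ (R *ᵖ (X ^ᵖ Q))      ≡⟨ cong₂ _+ᵖ_ (*ᵖ-identityʳ (^ᵖ-Normal X+1 n)) (*ᵖ-comm R (X ^ᵖ Q)) ⟩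
  R +ᵖ ((X ^ᵖ Q) *ᵖ R)                ∎
  where R = X+1 ^ᵖ n

X+1*-X+1^* : ∀ {n k N} → n + suc k ≡ N → X+1 *ᵖ ((X+1 ^ᵖ k) *ᵖ (X+1 ^ᵖ n)) ≡ X+1 ^ᵖ N
X+1*-X+1^* {n} {k} refl = begin
  X+1 *ᵖ ((X+1 ^ᵖ k) *ᵖ (X+1 ^ᵖ n))  ≡⟨ *ᵖ-assoc X+1 (X+1 ^ᵖ k) (X+1 ^ᵖ n) ⟨
  (X+1 ^ᵖ suc k) *ᵖ (X+1 ^ᵖ n)       ≡⟨ ^ᵖ-+ X+1 (suc k) n ⟨
  X+1 ^ᵖ (suc k + n)                 ≡⟨ cong (X+1 ^ᵖ_) (ℕ.+-comm (suc k) n) ⟩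
  X+1 ^ᵖ (n + suc k)                 ∎

-- timesX+1 s K = (X + 1) K + s, computed with a carry; divX1Aux s undoes it
timesX+1 : Bool → Poly → Poly
timesX+1 s [] = s ∷ []
timesX+1 s (k ∷ K) = (s xor k) ∷ timesX+1 k K

coef-timesX+1 : ∀ s K n → coef (timesX+1 s K) n ≡ coef (s ∷ K) n xor coef K n
coef-timesX+1 s [] zero = sym (xor-identityʳ s)
coef-timesX+1 s [] (suc n) = refl
coef-timesX+1 s (k ∷ K) zero = refl
coef-timesX+1 s (k ∷ K) (suc n) = coef-timesX+1 k K n

timesX+1-Normal : ∀ s {k K} → Normal (k ∷ K) → Normal (timesX+1 s (k ∷ K))
timesX+1-Normal s one = cons (s xor true) one
timesX+1-Normal s (cons a n) = cons (s xor a) (timesX+1-Normal a n)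

X+1*≡timesX+1 : ∀ {k K} → Normal (k ∷ K) → X+1 *ᵖ (k ∷ K) ≡ timesX+1 false (k ∷ K)
X+1*≡timesX+1 {k} {K} n = coef-injective (*ᵖ-Normal X+1 (k ∷ K)) (timesX+1-Normal false n) λ i → begin
  coef ((oneᵖ +ᵖ X) *ᵖ (k ∷ K)) i                   ≡⟨ cong (λ p → coef p i) (*ᵖ-distribʳ-+ᵖ oneᵖ X (k ∷ K)) ⟩
  coef ((oneᵖ *ᵖ (k ∷ K)) +ᵖ (X *ᵖ (k ∷ K))) i      ≡⟨ cong (λ p → coef (p +ᵖ (X *ᵖ (k ∷ K))) i) (*ᵖ-identityˡ n) ⟩
  coef ((k ∷ K) +ᵖ (X *ᵖ (k ∷ K))) i                ≡⟨ coef-+ᵖ (k ∷ K) (X *ᵖ (k ∷ K)) i ⟩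
  coef (k ∷ K) i xor coef (X *ᵖ (k ∷ K)) i          ≡⟨ cong (λ p → coef (k ∷ K) i xor coef p i) (X*-∷ n) ⟩
  coef (k ∷ K) i xor coef (false ∷ k ∷ K) i         ≡⟨ xor-comm (coef (k ∷ K) i) _ ⟩
  coef (false ∷ k ∷ K) i xor coef (k ∷ K) i         ≡⟨ coef-timesX+1 false (k ∷ K) i ⟨
  coef (timesX+1 false (k ∷ K)) i                   ∎

divX1Aux-timesX+1 : ∀ s K → divX1Aux s (timesX+1 s K) ≡ K
divX1Aux-timesX+1 s [] = refl
divX1Aux-timesX+1 s (k ∷ []) rewrite xor-cancelˡ s k = refl
divX1Aux-timesX+1 s (k ∷ k′ ∷ K) = cong₂ _∷_ (xor-cancelˡ s k)
  (trans (cong (λ t → divX1Aux t (timesX+1 k (k′ ∷ K))) (xor-cancelˡ s k)) (divX1Aux-timesX+1 k (k′ ∷ K)))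

evalOne-timesX+1 : ∀ s K → evalOne (timesX+1 s K) ≡ s
evalOne-timesX+1 s [] = xor-identityʳ s
evalOne-timesX+1 s (k ∷ K) = trans (cong ((s xor k) xor_) (evalOne-timesX+1 k K))
  (trans (xor-assoc s k k) (trans (cong (s xor_) (xor-same k)) (xor-identityʳ s)))

length-timesX+1 : ∀ s K → length (timesX+1 s K) ≡ suc (length K)
length-timesX+1 s [] = refl
length-timesX+1 s (k ∷ K) = cong suc (length-timesX+1 k K)

stripX1Fuel-X+1* : ∀ f {K} → Normal K → eval₀ K ≡ true → stripX1Fuel (suc f) (X+1 *ᵖ K) ≡ stripX1Fuel f K
stripX1Fuel-X+1* f {true ∷ K} n _
  rewrite X+1*≡timesX+1 n | evalOne-timesX+1 true K | divX1Aux-timesX+1 false (true ∷ K) = refl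

stripX1Fuel-odd : ∀ f {G} → eval₀ G ≡ true → evalOne G ≡ true → stripX1Fuel (suc f) G ≡ G
stripX1Fuel-odd f {true ∷ G} _ odd rewrite odd = refl

eval₀-X+1^ : ∀ e → eval₀ (X+1 ^ᵖ e) ≡ true
eval₀-X+1^ zero = refl
eval₀-X+1^ (suc e) = trans (eval₀-*ᵖ X+1 (X+1 ^ᵖ e)) (eval₀-X+1^ e)

eval₀-X+1^* : ∀ e G → eval₀ ((X+1 ^ᵖ e) *ᵖ G) ≡ eval₀ G
eval₀-X+1^* e G = trans (eval₀-*ᵖ (X+1 ^ᵖ e) G) (cong (_∧ eval₀ G) (eval₀-X+1^ e))

stripX1Fuel-X+1^* : ∀ e f {G} → e < f → Normal G → eval₀ G ≡ true → evalOne G ≡ true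
                  → stripX1Fuel f ((X+1 ^ᵖ e) *ᵖ G) ≡ G
stripX1Fuel-X+1^* zero (suc f) _ n even odd =
  trans (cong (stripX1Fuel (suc f)) (*ᵖ-identityˡ n)) (stripX1Fuel-odd f even odd)
stripX1Fuel-X+1^* (suc e) (suc f) {G} (s≤s e<f) n even odd = begin
  stripX1Fuel (suc f) ((X+1 *ᵖ (X+1 ^ᵖ e)) *ᵖ G) ≡⟨ cong (stripX1Fuel (suc f)) (*ᵖ-assoc X+1 (X+1 ^ᵖ e) G) ⟩
  stripX1Fuel (suc f) (X+1 *ᵖ ((X+1 ^ᵖ e) *ᵖ G)) ≡⟨ stripX1Fuel-X+1* f (*ᵖ-Normal (X+1 ^ᵖ e) G) (trans (eval₀-X+1^* e G) even) ⟩
  stripX1Fuel f ((X+1 ^ᵖ e) *ᵖ G)                ≡⟨ stripX1Fuel-X+1^* e f e<f n even odd ⟩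
  G                                              ∎

length-X+1* : ∀ {K} → Normal K → eval₀ K ≡ true → length (X+1 *ᵖ K) ≡ suc (length K)
length-X+1* {true ∷ K} n _ rewrite X+1*≡timesX+1 n = length-timesX+1 false (true ∷ K)

length-X+1^* : ∀ e {G} → Normal G → eval₀ G ≡ true → length ((X+1 ^ᵖ e) *ᵖ G) ≡ e + length G
length-X+1^* zero n _ = cong length (*ᵖ-identityˡ n)
length-X+1^* (suc e) {G} n even = begin
  length ((X+1 *ᵖ (X+1 ^ᵖ e)) *ᵖ G)  ≡⟨ cong length (*ᵖ-assoc X+1 (X+1 ^ᵖ e) G) ⟩
  length (X+1 *ᵖ ((X+1 ^ᵖ e) *ᵖ G))  ≡⟨ length-X+1* (*ᵖ-Normal (X+1 ^ᵖ e) G) (trans (eval₀-X+1^* e G) even) ⟩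
  suc (length ((X+1 ^ᵖ e) *ᵖ G))     ≡⟨ cong suc (length-X+1^* e n even) ⟩
  suc (e + length G)                 ∎

-- Substituting X² + X

X²+X : Poly
X²+X = false ∷ true ∷ true ∷ []

oddStep-X²+X^* : ∀ e {G} → Normal G → eval₀ G ≡ true → evalOne G ≡ true → oddStep ((X²+X ^ᵖ e) *ᵖ G) ≡ G
oddStep-X²+X^* e {G@(true ∷ _)} n even odd = begin
  stripX1 (stripX ((X²+X ^ᵖ e) *ᵖ G))              ≡⟨ cong (λ p → stripX1 (stripX p)) X²+X^e*G ⟩
  stripX1 (stripX ((X ^ᵖ e) *ᵖ H))                 ≡⟨ cong stripX1 (stripX-X^* e (*ᵖ-Normal (X+1 ^ᵖ e) G) evenH) ⟩
  stripX1Fuel (length H) H                          ≡⟨ cong (λ l → stripX1Fuel l H) (length-X+1^* e n even) ⟩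
  stripX1Fuel (e + length G) H                      ≡⟨ stripX1Fuel-X+1^* e (e + length G) (ℕ.m<m+n e z<s) n even odd ⟩
  G                                                 ∎
  where
  H = (X+1 ^ᵖ e) *ᵖ G
  X²+X^e*G : (X²+X ^ᵖ e) *ᵖ G ≡ (X ^ᵖ e) *ᵖ H
  X²+X^e*G = trans (cong (_*ᵖ G) (*ᵖ-^ X X+1 e)) (*ᵖ-assoc (X ^ᵖ e) (X+1 ^ᵖ e) G)
  evenH : eval₀ H ≡ true
  evenH = trans (eval₀-X+1^* e G) even

-- φ p = p(X² + X); note φ (X + 1) = M
φ : Poly → Poly
φ [] = []
φ (a ∷ p) = scale a oneᵖ +ᵖ (X²+X *ᵖ φ p)

φ-Normal : ∀ p → Normal (φ p)
φ-Normal [] = nil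
φ-Normal (a ∷ p) = +ᵖ-Normal (scale a oneᵖ) (X²+X *ᵖ φ p)

φ-norm : ∀ p → φ (norm p) ≡ φ p
φ-norm [] = refl
φ-norm (a ∷ p) rewrite norm-∷ a p = trans (φ-⊲ a (norm p)) (cong (λ q → scale a oneᵖ +ᵖ (X²+X *ᵖ q)) (φ-norm p))
  where
  φ-⊲ : ∀ a q → φ (a ⊲ q) ≡ scale a oneᵖ +ᵖ (X²+X *ᵖ φ q)
  φ-⊲ true [] = refl
  φ-⊲ false [] = refl
  φ-⊲ a (b ∷ q) = refl

φ-addRaw : ∀ p q → φ (addRaw p q) ≡ φ p +ᵖ φ q
φ-addRaw [] q = sym (+ᵖ-identityˡ (φ-Normal q))
φ-addRaw (a ∷ p) [] = sym (+ᵖ-identityʳ (φ-Normal (a ∷ p)))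
φ-addRaw (a ∷ p) (b ∷ q) = begin
  scale (a xor b) oneᵖ +ᵖ (X²+X *ᵖ φ (addRaw p q))
    ≡⟨ cong₂ _+ᵖ_ (scale-xor a b one) (trans (cong (X²+X *ᵖ_) (φ-addRaw p q)) (*ᵖ-distribˡ-+ᵖ X²+X (φ p) (φ q))) ⟩
  (scale a oneᵖ +ᵖ scale b oneᵖ) +ᵖ ((X²+X *ᵖ φ p) +ᵖ (X²+X *ᵖ φ q))
    ≡⟨ +ᵖ.interchange (scale a oneᵖ) (scale b oneᵖ) (X²+X *ᵖ φ p) (X²+X *ᵖ φ q) ⟩
  φ (a ∷ p) +ᵖ φ (b ∷ q) ∎

φ-+ᵖ : ∀ p q → φ (p +ᵖ q) ≡ φ p +ᵖ φ q
φ-+ᵖ p q = trans (φ-norm (addRaw p q)) (φ-addRaw p q)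

φ-*ᵖ : ∀ p q → φ (p *ᵖ q) ≡ φ p *ᵖ φ q
φ-*ᵖ [] q = refl
φ-*ᵖ (a ∷ p) q = begin
  φ (scale a q +ᵖ shift (p *ᵖ q))                  ≡⟨ φ-+ᵖ (scale a q) (shift (p *ᵖ q)) ⟩
  φ (scale a q) +ᵖ φ (shift (p *ᵖ q))              ≡⟨ cong₂ _+ᵖ_ (φ-scale a) (φ-shift (p *ᵖ q)) ⟩
  scale a (φ q) +ᵖ (X²+X *ᵖ φ (p *ᵖ q))           ≡⟨ cong (λ r → scale a (φ q) +ᵖ (X²+X *ᵖ r)) (φ-*ᵖ p q) ⟩
  scale a (φ q) +ᵖ (X²+X *ᵖ (φ p *ᵖ φ q))         ≡⟨ cong₂ _+ᵖ_ (scale-one a) (*ᵖ-assoc X²+X (φ p) (φ q)) ⟨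
  (scale a oneᵖ *ᵖ φ q) +ᵖ ((X²+X *ᵖ φ p) *ᵖ φ q) ≡⟨ *ᵖ-distribʳ-+ᵖ (scale a oneᵖ) (X²+X *ᵖ φ p) (φ q) ⟨
  φ (a ∷ p) *ᵖ φ q                                 ∎
  where
  φ-scale : ∀ a → φ (scale a q) ≡ scale a (φ q)
  φ-scale true = refl
  φ-scale false = refl
  φ-shift : ∀ r → φ (shift r) ≡ X²+X *ᵖ φ r
  φ-shift r = trans (φ-norm (false ∷ r)) (+ᵖ-identityˡ (*ᵖ-Normal X²+X (φ r)))
  scale-one : ∀ a → scale a oneᵖ *ᵖ φ q ≡ scale a (φ q)
  scale-one true = *ᵖ-identityˡ (φ-Normal q)
  scale-one false = refl

φ-^ᵖ : ∀ p n → φ (p ^ᵖ n) ≡ φ p ^ᵖ n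
φ-^ᵖ p zero = refl
φ-^ᵖ p (suc n) = trans (φ-*ᵖ p (p ^ᵖ n)) (cong (φ p *ᵖ_) (φ-^ᵖ p n))

-- X² + X vanishes at both 0 and 1
eval₀-φ : ∀ p → eval₀ (φ p) ≡ eval₀ p
eval₀-φ [] = refl
eval₀-φ (a ∷ p) = begin
  eval₀ (scale a oneᵖ +ᵖ (X²+X *ᵖ φ p))                  ≡⟨ eval₀-+ᵖ (scale a oneᵖ) (X²+X *ᵖ φ p) ⟩
  eval₀ (scale a oneᵖ) xor eval₀ (X²+X *ᵖ φ p)          ≡⟨ cong₂ _xor_ (coef-scale a oneᵖ 0) (eval₀-*ᵖ X²+X (φ p)) ⟩
  (a ∧ true) xor false                                  ≡⟨ trans (xor-identityʳ (a ∧ true)) (∧-identityʳ a) ⟩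
  a                                                     ∎

evalOne-φ : ∀ p → evalOne (φ p) ≡ eval₀ p
evalOne-φ [] = refl
evalOne-φ (a ∷ p) = begin
  evalOne (scale a oneᵖ +ᵖ (X²+X *ᵖ φ p))                ≡⟨ evalOne-+ᵖ (scale a oneᵖ) (X²+X *ᵖ φ p) ⟩
  evalOne (scale a oneᵖ) xor evalOne (X²+X *ᵖ φ p)      ≡⟨ cong₂ _xor_ (evalOne-scale a) (evalOne-*ᵖ X²+X (φ p)) ⟩
  a xor false                                           ≡⟨ xor-identityʳ a ⟩
  a                                                     ∎
  where
  evalOne-scale : ∀ a → evalOne (scale a oneᵖ) ≡ a
  evalOne-scale true = refl
  evalOne-scale false = refl

T : Poly → Poly
T B = stripX (oneᵖ +ᵖ (X+1 *ᵖ B))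

ordT : Poly → ℕ
ordT B = ordX (oneᵖ +ᵖ (X+1 *ᵖ B))

ordSum : ℕ → Poly → ℕ
ordSum zero B = 0
ordSum (suc k) B = ordT B + ordSum k (T B)

eval₀-T : ∀ B → eval₀ (T B) ≡ true
eval₀-T B = eval₀-stripX (oneᵖ +ᵖ (X+1 *ᵖ B))
  (trans (evalOne-+ᵖ oneᵖ (X+1 *ᵖ B)) (cong (true xor_) (evalOne-*ᵖ X+1 B)))

X^ordT*T : ∀ B → (X ^ᵖ ordT B) *ᵖ T B ≡ oneᵖ +ᵖ (X+1 *ᵖ B)
X^ordT*T B = X^ordX*stripX (+ᵖ-Normal oneᵖ (X+1 *ᵖ B))

T-unique : ∀ B e {C} → Normal C → eval₀ C ≡ true → oneᵖ +ᵖ (X+1 *ᵖ B) ≡ (X ^ᵖ e) *ᵖ C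
         → T B ≡ C × ordT B ≡ e
T-unique B e n even eq = trans (cong stripX eq) (stripX-X^* e n even) , trans (cong ordX eq) (ordX-X^* e n even)

φ-T : ∀ B → oddStep (evenStep (φ B)) ≡ φ (T B)
φ-T B = begin
  oddStep (oneᵖ +ᵖ (φ X+1 *ᵖ φ B))             ≡⟨ cong oddStep (trans (φ-+ᵖ oneᵖ (X+1 *ᵖ B)) (cong (oneᵖ +ᵖ_) (φ-*ᵖ X+1 B))) ⟨
  oddStep (φ (oneᵖ +ᵖ (X+1 *ᵖ B)))             ≡⟨ cong (λ p → oddStep (φ p)) (X^ordT*T B) ⟨
  oddStep (φ ((X ^ᵖ ordT B) *ᵖ T B))           ≡⟨ cong oddStep (trans (φ-*ᵖ (X ^ᵖ ordT B) (T B)) (cong (_*ᵖ φ (T B)) (φ-^ᵖ X (ordT B)))) ⟩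
  oddStep ((X²+X ^ᵖ ordT B) *ᵖ φ (T B))        ≡⟨ oddStep-X²+X^* (ordT B) (φ-Normal (T B)) (trans (eval₀-φ (T B)) (eval₀-T B)) (trans (evalOne-φ (T B)) (eval₀-T B)) ⟩
  φ (T B)                                      ∎

iterate-suc : ∀ {A : Set} (f : A → A) x k → iterate f x (suc k) ≡ f (iterate f x k)
iterate-suc f x zero = refl
iterate-suc f x (suc k) = iterate-suc f (f x) k

iterate-+ : ∀ {A : Set} (f : A → A) x m n → iterate f x (m + n) ≡ iterate f (iterate f x m) n
iterate-+ f x zero n = refl
iterate-+ f x (suc m) n = iterate-+ f (f x) m n

ordSum-+ : ∀ m n B → ordSum (m + n) B ≡ ordSum m B + ordSum n (iterate T B m)
ordSum-+ zero n B = refl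
ordSum-+ (suc m) n B = trans (cong (ordT B +_) (ordSum-+ m n (T B))) (sym (ℕ.+-assoc (ordT B) (ordSum m (T B)) _))

oddTerm-φ : ∀ {B} → eval₀ B ≡ true → ∀ k → oddTerm (φ B) k ≡ φ (iterate T B k)
oddTerm-φ {B} even zero =
  trans (cong oddStep (sym (*ᵖ-identityˡ (φ-Normal B))))
        (oddStep-X²+X^* 0 (φ-Normal B) (trans (eval₀-φ B) even) (trans (evalOne-φ B) even))
oddTerm-φ {B} even (suc k) =
  trans (cong (λ p → oddStep (evenStep p)) (oddTerm-φ even k))
        (trans (φ-T (iterate T B k)) (cong φ (sym (iterate-suc T B k))))

T-perturb : ∀ R D {t} → 0 < t → let B = R +ᵖ ((X ^ᵖ (ordT R + t)) *ᵖ D) in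
            T B ≡ T R +ᵖ ((X ^ᵖ t) *ᵖ (X+1 *ᵖ D)) × ordT B ≡ ordT R
T-perturb R D {suc t} _ = T-unique (R +ᵖ ((X ^ᵖ (e + suc t)) *ᵖ D)) e (+ᵖ-Normal (T R) _) even eq
  where
  e = ordT R
  V = X+1 *ᵖ D
  even : eval₀ (T R +ᵖ ((X ^ᵖ suc t) *ᵖ V)) ≡ true
  even = trans (eval₀-+ᵖ (T R) _) (cong₂ _xor_ (eval₀-T R) (eval₀-X^suc* t V))
  eq : oneᵖ +ᵖ (X+1 *ᵖ (R +ᵖ ((X ^ᵖ (e + suc t)) *ᵖ D))) ≡ (X ^ᵖ e) *ᵖ (T R +ᵖ ((X ^ᵖ suc t) *ᵖ V))
  eq = begin
    oneᵖ +ᵖ (X+1 *ᵖ (R +ᵖ ((X ^ᵖ (e + suc t)) *ᵖ D)))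
      ≡⟨ cong (oneᵖ +ᵖ_) (X+1*-+X^* R (e + suc t) D) ⟩
    oneᵖ +ᵖ ((X+1 *ᵖ R) +ᵖ ((X ^ᵖ (e + suc t)) *ᵖ V))
      ≡⟨ +ᵖ-assoc oneᵖ (X+1 *ᵖ R) _ ⟨
    (oneᵖ +ᵖ (X+1 *ᵖ R)) +ᵖ ((X ^ᵖ (e + suc t)) *ᵖ V)
      ≡⟨ cong₂ _+ᵖ_ (X^ordT*T R) (X^+* e (suc t) V) ⟨
    ((X ^ᵖ e) *ᵖ T R) +ᵖ ((X ^ᵖ e) *ᵖ ((X ^ᵖ suc t) *ᵖ V))
      ≡⟨ *ᵖ-distribˡ-+ᵖ (X ^ᵖ e) (T R) _ ⟨
    (X ^ᵖ e) *ᵖ (T R +ᵖ ((X ^ᵖ suc t) *ᵖ V)) ∎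

iterate-T-perturb : ∀ L R D {t} → 0 < t → let B = R +ᵖ ((X ^ᵖ (ordSum L R + t)) *ᵖ D) in
  iterate T B L ≡ iterate T R L +ᵖ ((X ^ᵖ t) *ᵖ ((X+1 ^ᵖ L) *ᵖ D)) × ordSum L B ≡ ordSum L R
iterate-T-perturb zero R D {t} _ =
  cong (R +ᵖ_) (sym (trans (cong ((X ^ᵖ t) *ᵖ_) (oneᵖ*ᵖ≡norm D)) (*ᵖ-normʳ (X ^ᵖ t) D))) , refl
iterate-T-perturb (suc L) R D {t} t>0 = iterate-eq , ordSum-eq
  where
  e = ordT R
  E′ = ordSum L (T R)
  B = R +ᵖ ((X ^ᵖ ((e + E′) + t)) *ᵖ D)
  step = T-perturb R D {E′ + t} (ℕ.<-≤-trans t>0 (ℕ.m≤n+m t E′))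
  ih = iterate-T-perturb L (T R) (X+1 *ᵖ D) t>0
  B≡ : B ≡ R +ᵖ ((X ^ᵖ (e + (E′ + t))) *ᵖ D)
  B≡ = cong (λ m → R +ᵖ ((X ^ᵖ m) *ᵖ D)) (ℕ.+-assoc e E′ t)
  TB≡ : T B ≡ T R +ᵖ ((X ^ᵖ (E′ + t)) *ᵖ (X+1 *ᵖ D))
  TB≡ = trans (cong T B≡) (proj₁ step)
  iterate-eq : iterate T (T B) L ≡ iterate T (T R) L +ᵖ ((X ^ᵖ t) *ᵖ ((X+1 ^ᵖ suc L) *ᵖ D))
  iterate-eq = begin
    iterate T (T B) L                                                  ≡⟨ cong (λ C → iterate T C L) TB≡ ⟩
    iterate T (T R +ᵖ ((X ^ᵖ (E′ + t)) *ᵖ (X+1 *ᵖ D))) L              ≡⟨ proj₁ ih ⟩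
    iterate T (T R) L +ᵖ ((X ^ᵖ t) *ᵖ ((X+1 ^ᵖ L) *ᵖ (X+1 *ᵖ D)))    ≡⟨ cong (λ V → iterate T (T R) L +ᵖ ((X ^ᵖ t) *ᵖ V)) (*ᵖ.x∙yz≈yx∙z (X+1 ^ᵖ L) X+1 D) ⟩
    iterate T (T R) L +ᵖ ((X ^ᵖ t) *ᵖ ((X+1 ^ᵖ suc L) *ᵖ D))          ∎
  ordSum-eq : ordT B + ordSum L (T B) ≡ e + E′
  ordSum-eq = cong₂ _+_ (trans (cong ordT B≡) (proj₂ step)) (trans (cong (ordSum L) TB≡) (proj₂ ih))

X+1*-+oneᵖ : ∀ B → X+1 *ᵖ (B +ᵖ oneᵖ) ≡ (X+1 *ᵖ B) +ᵖ X+1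
X+1*-+oneᵖ B = trans (*ᵖ-distribˡ-+ᵖ X+1 B oneᵖ) (cong ((X+1 *ᵖ B) +ᵖ_) (*ᵖ-identityʳ X+1-Normal))

[1+[X+1]B]+X≡[X+1][B+1] : ∀ B → (oneᵖ +ᵖ (X+1 *ᵖ B)) +ᵖ X ≡ X+1 *ᵖ (B +ᵖ oneᵖ)
[1+[X+1]B]+X≡[X+1][B+1] B = begin
  (oneᵖ +ᵖ (X+1 *ᵖ B)) +ᵖ X         ≡⟨ +ᵖ.xy∙z≈y∙xz oneᵖ (X+1 *ᵖ B) X ⟩
  (X+1 *ᵖ B) +ᵖ X+1                 ≡⟨ X+1*-+oneᵖ B ⟨
  X+1 *ᵖ (B +ᵖ oneᵖ)                ∎

X+1*-from-+oneᵖ : ∀ B {W} → X+1 *ᵖ (B +ᵖ oneᵖ) ≡ X *ᵖ (oneᵖ +ᵖ W) → X+1 *ᵖ B ≡ oneᵖ +ᵖ (X *ᵖ W)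
X+1*-from-+oneᵖ B {W} hyp = begin
  X+1 *ᵖ B                                ≡⟨ +ᵖ-moveʳ X+1 (X+1 *ᵖ (B +ᵖ oneᵖ)) (*ᵖ-Normal X+1 B) (sym (X+1*-+oneᵖ B)) ⟩
  (X+1 *ᵖ (B +ᵖ oneᵖ)) +ᵖ X+1             ≡⟨ cong (_+ᵖ X+1) hyp ⟩
  (X *ᵖ (oneᵖ +ᵖ W)) +ᵖ X+1               ≡⟨ cong (_+ᵖ X+1) (trans (*ᵖ-distribˡ-+ᵖ X oneᵖ W) (cong (_+ᵖ (X *ᵖ W)) (*ᵖ-identityʳ X-Normal))) ⟩
  (X +ᵖ (X *ᵖ W)) +ᵖ (oneᵖ +ᵖ X)          ≡⟨ cong₂ _+ᵖ_ (+ᵖ-comm X (X *ᵖ W)) (+ᵖ-comm oneᵖ X) ⟩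
  ((X *ᵖ W) +ᵖ X) +ᵖ (X +ᵖ oneᵖ)          ≡⟨ +ᵖ-cancel-middle (X *ᵖ W) X one ⟩
  (X *ᵖ W) +ᵖ oneᵖ                        ≡⟨ +ᵖ-comm (X *ᵖ W) oneᵖ ⟩
  oneᵖ +ᵖ (X *ᵖ W)                        ∎

iterate-T-chain : ∀ p w B → (X+1 ^ᵖ suc p) *ᵖ (B +ᵖ oneᵖ) ≡ (X ^ᵖ suc p) *ᵖ (oneᵖ +ᵖ (X ^ᵖ w))
  → ordSum p B ≡ p × X+1 *ᵖ iterate T B p ≡ oneᵖ +ᵖ (X ^ᵖ suc w)
iterate-T-chain zero w B hyp = refl , X+1*-from-+oneᵖ B {X ^ᵖ w} hyp
iterate-T-chain (suc p) w B hyp = cong₂ _+_ (proj₂ TB≡C) (trans (cong (ordSum p) (proj₁ TB≡C)) (proj₁ ih)) ,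
                                   trans (cong (λ D → X+1 *ᵖ iterate T D p) (proj₁ TB≡C)) (proj₂ ih)
  where
  W = oneᵖ +ᵖ (X ^ᵖ w)
  even-B : eval₀ B ≡ true
  even-B = xor-true-false (eval₀ B)
    (trans (sym (trans (eval₀-X+1^* (suc (suc p)) (B +ᵖ oneᵖ)) (eval₀-+ᵖ B oneᵖ)))
           (trans (cong eval₀ hyp) (eval₀-X^suc* (suc p) W)))
  divisible : ∃ λ C → Normal C × oneᵖ +ᵖ (X+1 *ᵖ B) ≡ X *ᵖ C
  divisible = X-divides (+ᵖ-Normal oneᵖ (X+1 *ᵖ B))
    (trans (eval₀-+ᵖ oneᵖ (X+1 *ᵖ B)) (cong (true xor_) (trans (eval₀-*ᵖ X+1 B) even-B)))
  C = proj₁ divisible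
  nC = proj₁ (proj₂ divisible)
  c≡XC = proj₂ (proj₂ divisible)
  hyp-C : (X+1 ^ᵖ suc p) *ᵖ (C +ᵖ oneᵖ) ≡ (X ^ᵖ suc p) *ᵖ W
  hyp-C = X*-cancel (*ᵖ-Normal (X+1 ^ᵖ suc p) _) (*ᵖ-Normal (X ^ᵖ suc p) W) (begin
    X *ᵖ ((X+1 ^ᵖ suc p) *ᵖ (C +ᵖ oneᵖ))           ≡⟨ *ᵖ-lcomm X (X+1 ^ᵖ suc p) (C +ᵖ oneᵖ) ⟩
    (X+1 ^ᵖ suc p) *ᵖ (X *ᵖ (C +ᵖ oneᵖ))           ≡⟨ cong ((X+1 ^ᵖ suc p) *ᵖ_) (*ᵖ-distribˡ-+ᵖ X C oneᵖ) ⟩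
    (X+1 ^ᵖ suc p) *ᵖ ((X *ᵖ C) +ᵖ X)              ≡⟨ cong (λ c → (X+1 ^ᵖ suc p) *ᵖ (c +ᵖ X)) c≡XC ⟨
    (X+1 ^ᵖ suc p) *ᵖ ((oneᵖ +ᵖ (X+1 *ᵖ B)) +ᵖ X)  ≡⟨ cong ((X+1 ^ᵖ suc p) *ᵖ_) ([1+[X+1]B]+X≡[X+1][B+1] B) ⟩
    (X+1 ^ᵖ suc p) *ᵖ (X+1 *ᵖ (B +ᵖ oneᵖ))         ≡⟨ *ᵖ-lcomm (X+1 ^ᵖ suc p) X+1 (B +ᵖ oneᵖ) ⟩
    X+1 *ᵖ ((X+1 ^ᵖ suc p) *ᵖ (B +ᵖ oneᵖ))         ≡⟨ *ᵖ-assoc X+1 (X+1 ^ᵖ suc p) (B +ᵖ oneᵖ) ⟨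
    (X+1 ^ᵖ suc (suc p)) *ᵖ (B +ᵖ oneᵖ)            ≡⟨ hyp ⟩
    (X ^ᵖ suc (suc p)) *ᵖ W                        ≡⟨ *ᵖ-assoc X (X ^ᵖ suc p) W ⟩
    X *ᵖ ((X ^ᵖ suc p) *ᵖ W)                       ∎)
  even-C : eval₀ C ≡ true
  even-C = xor-true-false (eval₀ C)
    (trans (sym (trans (eval₀-X+1^* (suc p) (C +ᵖ oneᵖ)) (eval₀-+ᵖ C oneᵖ)))
           (trans (cong eval₀ hyp-C) (eval₀-X^suc* p W)))
  TB≡C : T B ≡ C × ordT B ≡ 1
  TB≡C = T-unique B 1 nC even-C c≡XC
  ih = iterate-T-chain p w C hyp-C

-- Orbits of powers of X + 1

-- final says that T^(k+1) ((X + 1)ⁿ) = 1, the last step dividing out X^exponent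
record Descent (Q n k : ℕ) : Set where
  field
    exponent        : ℕ
    ordSum<Q        : ordSum k (X+1 ^ᵖ n) < Q
    exponent+ordSum : exponent + ordSum k (X+1 ^ᵖ n) ≡ Q + Q
    final           : X+1 *ᵖ iterate T (X+1 ^ᵖ n) k ≡ oneᵖ +ᵖ (X ^ᵖ exponent)

Descent-exponent>Q : ∀ {Q n k} (d : Descent Q n k) → Q < Descent.exponent d
Descent-exponent>Q {Q} {n} {k} d =
  ℕ.+-cancelʳ-< (ordSum k (X+1 ^ᵖ n)) Q exponent
    (ℕ.<-≤-trans (ℕ.+-monoʳ-< Q ordSum<Q) (ℕ.≤-reflexive (sym exponent+ordSum)))
  where open Descent d

descent-base : Descent 1 1 0
descent-base = record { exponent = 2 ; ordSum<Q = z<s ; exponent+ordSum = refl ; final = refl }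

descent-lower : ∀ {P n k} → IsPow2 P → n + suc k ≡ P + P → Descent P n k → Descent (P + P) (n + (P + P)) k
descent-lower {P} {n} {k} pow size d = record
  { exponent = f + (P + P)
  ; ordSum<Q = subst (_< P + P) (sym ord≡) (ℕ.<-≤-trans ordSum<Q (ℕ.m≤m+n P P))
  ; exponent+ordSum = begin
      (f + (P + P)) + ordSum k B   ≡⟨ cong ((f + (P + P)) +_) ord≡ ⟩
      (f + (P + P)) + E            ≡⟨ ℕ.+-assoc f (P + P) E ⟩
      f + ((P + P) + E)            ≡⟨ cong (f +_) (ℕ.+-comm (P + P) E) ⟩
      f + (E + (P + P))            ≡⟨ ℕ.+-assoc f E (P + P) ⟨
      (f + E) + (P + P)            ≡⟨ cong (_+ (P + P)) exponent+ordSum ⟩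
      (P + P) + (P + P)            ∎
  ; final = begin
      X+1 *ᵖ iterate T B k                                              ≡⟨ cong (X+1 *ᵖ_) iter≡ ⟩
      X+1 *ᵖ (iterate T R k +ᵖ ((X ^ᵖ f) *ᵖ ((X+1 ^ᵖ k) *ᵖ R)))          ≡⟨ X+1*-+X^* (iterate T R k) f _ ⟩
      (X+1 *ᵖ iterate T R k) +ᵖ ((X ^ᵖ f) *ᵖ (X+1 *ᵖ ((X+1 ^ᵖ k) *ᵖ R))) ≡⟨ cong₂ (λ u v → u +ᵖ ((X ^ᵖ f) *ᵖ v)) final (trans (X+1*-X+1^* size) (X+1^-IsPow2 (two^suc pow))) ⟩
      (oneᵖ +ᵖ (X ^ᵖ f)) +ᵖ ((X ^ᵖ f) *ᵖ (oneᵖ +ᵖ (X ^ᵖ (P + P))))      ≡⟨ [1+p]+p[1+q]≡1+pq (X ^ᵖ (P + P)) (^ᵖ-Normal X f) ⟩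
      oneᵖ +ᵖ ((X ^ᵖ f) *ᵖ (X ^ᵖ (P + P)))                              ≡⟨ cong (oneᵖ +ᵖ_) (^ᵖ-+ X f (P + P)) ⟨
      oneᵖ +ᵖ (X ^ᵖ (f + (P + P)))                                       ∎
  }
  where
  open Descent d renaming (exponent to f)
  R = X+1 ^ᵖ n
  E = ordSum k R
  B = X+1 ^ᵖ (n + (P + P))
  B≡ : B ≡ R +ᵖ ((X ^ᵖ (E + f)) *ᵖ R)
  B≡ = trans (X+1^+IsPow2 (two^suc pow) n)
             (cong (λ m → R +ᵖ ((X ^ᵖ m) *ᵖ R)) (trans (sym exponent+ordSum) (ℕ.+-comm f E)))
  pert = iterate-T-perturb k R R (ℕ.<-trans (IsPow2-positive pow) (Descent-exponent>Q d))
  iter≡ : iterate T B k ≡ iterate T R k +ᵖ ((X ^ᵖ f) *ᵖ ((X+1 ^ᵖ k) *ᵖ R))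
  iter≡ = trans (cong (λ C → iterate T C k) B≡) (proj₁ pert)
  ord≡ : ordSum k B ≡ E
  ord≡ = trans (cong (ordSum k) B≡) (proj₂ pert)

turn : ℕ → Poly
turn P = (X ^ᵖ P) +ᵖ (X+1 ^ᵖ (P + P))

eval₀-turn : ∀ {P} → 0 < P → eval₀ (turn P) ≡ true
eval₀-turn {suc p} _ = trans (eval₀-+ᵖ (X ^ᵖ suc p) _)
  (cong₂ _xor_ (eval₀-X^suc p) (eval₀-X+1^ (suc p + suc p)))

X+1^*[turn+1] : ∀ {P} → IsPow2 P → (X+1 ^ᵖ P) *ᵖ (turn P +ᵖ oneᵖ) ≡ (X ^ᵖ P) *ᵖ (oneᵖ +ᵖ (X ^ᵖ (P + P)))
X+1^*[turn+1] {P} pow = begin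
  S^P *ᵖ (((X ^ᵖ P) +ᵖ S^2P) +ᵖ oneᵖ)          ≡⟨ cong (S^P *ᵖ_) (+ᵖ-assoc (X ^ᵖ P) S^2P oneᵖ) ⟩
  S^P *ᵖ ((X ^ᵖ P) +ᵖ (S^2P +ᵖ oneᵖ))          ≡⟨ cong (λ c → S^P *ᵖ ((X ^ᵖ P) +ᵖ (c +ᵖ oneᵖ))) (X+1^-IsPow2 (two^suc pow)) ⟩
  S^P *ᵖ ((X ^ᵖ P) +ᵖ ((oneᵖ +ᵖ (X ^ᵖ (P + P))) +ᵖ oneᵖ)) ≡⟨ cong (λ c → S^P *ᵖ ((X ^ᵖ P) +ᵖ c)) (trans (+ᵖ-comm (oneᵖ +ᵖ (X ^ᵖ (P + P))) oneᵖ) (1+[1+p]≡p (^ᵖ-Normal X (P + P)))) ⟩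
  S^P *ᵖ ((X ^ᵖ P) +ᵖ (X ^ᵖ (P + P)))          ≡⟨ cong (S^P *ᵖ_) X^P+X^2P ⟩
  S^P *ᵖ ((X ^ᵖ P) *ᵖ S^P)                     ≡⟨ *ᵖ-lcomm S^P (X ^ᵖ P) S^P ⟩
  (X ^ᵖ P) *ᵖ (S^P *ᵖ S^P)                     ≡⟨ cong ((X ^ᵖ P) *ᵖ_) (trans (sym (^ᵖ-+ X+1 P P)) (X+1^-IsPow2 (two^suc pow))) ⟩
  (X ^ᵖ P) *ᵖ (oneᵖ +ᵖ (X ^ᵖ (P + P)))         ∎
  where
  S^P = X+1 ^ᵖ P
  S^2P = X+1 ^ᵖ (P + P)
  X^P+X^2P : (X ^ᵖ P) +ᵖ (X ^ᵖ (P + P)) ≡ (X ^ᵖ P) *ᵖ S^P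
  X^P+X^2P = begin
    (X ^ᵖ P) +ᵖ (X ^ᵖ (P + P))                  ≡⟨ cong₂ _+ᵖ_ (*ᵖ-identityʳ (^ᵖ-Normal X P)) (sym (^ᵖ-+ X P P)) ⟨
    ((X ^ᵖ P) *ᵖ oneᵖ) +ᵖ ((X ^ᵖ P) *ᵖ (X ^ᵖ P)) ≡⟨ *ᵖ-distribˡ-+ᵖ (X ^ᵖ P) oneᵖ (X ^ᵖ P) ⟨
    (X ^ᵖ P) *ᵖ (oneᵖ +ᵖ (X ^ᵖ P))              ≡⟨ cong ((X ^ᵖ P) *ᵖ_) (X+1^-IsPow2 pow) ⟨
    (X ^ᵖ P) *ᵖ S^P                             ∎

T-turn : ∀ {P} → IsPow2 P → ∀ U V f t → X+1 *ᵖ U ≡ oneᵖ +ᵖ (X ^ᵖ f) → f ≡ t + P → X+1 *ᵖ V ≡ X+1 ^ᵖ (P + P)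
       → oneᵖ +ᵖ (X+1 *ᵖ (U +ᵖ ((X ^ᵖ t) *ᵖ V))) ≡ (X ^ᵖ t) *ᵖ turn P
T-turn {P} pow U V f t last f≡ SV = begin
  oneᵖ +ᵖ (X+1 *ᵖ (U +ᵖ ((X ^ᵖ t) *ᵖ V)))                 ≡⟨ cong (oneᵖ +ᵖ_) (X+1*-+X^* U t V) ⟩
  oneᵖ +ᵖ ((X+1 *ᵖ U) +ᵖ ((X ^ᵖ t) *ᵖ (X+1 *ᵖ V)))        ≡⟨ +ᵖ-assoc oneᵖ (X+1 *ᵖ U) _ ⟨
  (oneᵖ +ᵖ (X+1 *ᵖ U)) +ᵖ ((X ^ᵖ t) *ᵖ (X+1 *ᵖ V))        ≡⟨ cong₂ (λ u v → (oneᵖ +ᵖ u) +ᵖ ((X ^ᵖ t) *ᵖ v)) last SV ⟩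
  (oneᵖ +ᵖ (oneᵖ +ᵖ (X ^ᵖ f))) +ᵖ ((X ^ᵖ t) *ᵖ (X+1 ^ᵖ (P + P))) ≡⟨ cong (_+ᵖ ((X ^ᵖ t) *ᵖ (X+1 ^ᵖ (P + P)))) (1+[1+p]≡p (^ᵖ-Normal X f)) ⟩
  (X ^ᵖ f) +ᵖ ((X ^ᵖ t) *ᵖ (X+1 ^ᵖ (P + P)))              ≡⟨ cong (λ m → (X ^ᵖ m) +ᵖ ((X ^ᵖ t) *ᵖ (X+1 ^ᵖ (P + P)))) f≡ ⟩
  (X ^ᵖ (t + P)) +ᵖ ((X ^ᵖ t) *ᵖ (X+1 ^ᵖ (P + P)))        ≡⟨ cong (_+ᵖ ((X ^ᵖ t) *ᵖ (X+1 ^ᵖ (P + P)))) (^ᵖ-+ X t P) ⟩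
  ((X ^ᵖ t) *ᵖ (X ^ᵖ P)) +ᵖ ((X ^ᵖ t) *ᵖ (X+1 ^ᵖ (P + P))) ≡⟨ *ᵖ-distribˡ-+ᵖ (X ^ᵖ t) (X ^ᵖ P) _ ⟨
  (X ^ᵖ t) *ᵖ turn P                                      ∎

descent-upper : ∀ {P n k} → IsPow2 P → n + suc k ≡ P + P → Descent P n k → Descent (P + P) (n + P) (k + P)
descent-upper {P} {n} {k} pow size d with IsPow2-positive pow
... | s≤s {n = p} z≤n = record
  { exponent = suc (P + P)
  ; ordSum<Q = subst (_< P + P) (sym ord≡) (ℕ.+-monoʳ-< P ℕ.≤-refl)
  ; exponent+ordSum = trans (cong (suc (P + P) +_) ord≡)
                      (sym (trans (cong ((P + P) +_) (ℕ.+-suc P p)) (ℕ.+-suc (P + P) (P + p))))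
  ; final = trans (cong (X+1 *ᵖ_) iter≡) (proj₂ chain)
  }
  where
  open Descent d renaming (exponent to f)
  R = X+1 ^ᵖ n
  E = ordSum k R
  gap = ℕ.m≤n⇒∃[o]m+o≡n ordSum<Q
  t = suc (proj₁ gap)
  P≡E+t : P ≡ E + t
  P≡E+t = sym (trans (ℕ.+-suc E (proj₁ gap)) (proj₂ gap))
  f≡t+P : f ≡ t + P
  f≡t+P = ℕ.+-cancelʳ-≡ E f (t + P) (begin
    f + E          ≡⟨ exponent+ordSum ⟩
    P + P          ≡⟨ cong (P +_) P≡E+t ⟩
    P + (E + t)    ≡⟨ solve 3 (λ P E t → P :+ (E :+ t) := (t :+ P) :+ E) refl P E t ⟩
    (t + P) + E    ∎)
  B = X+1 ^ᵖ (n + P)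
  pert = iterate-T-perturb k R R {t} z<s
  B≡ : B ≡ R +ᵖ ((X ^ᵖ (E + t)) *ᵖ R)
  B≡ = trans (X+1^+IsPow2 pow n) (cong (λ m → R +ᵖ ((X ^ᵖ m) *ᵖ R)) P≡E+t)
  Bₖ = iterate T B k
  Bₖ≡ : Bₖ ≡ iterate T R k +ᵖ ((X ^ᵖ t) *ᵖ ((X+1 ^ᵖ k) *ᵖ R))
  Bₖ≡ = trans (cong (λ C → iterate T C k) B≡) (proj₁ pert)
  turning : T Bₖ ≡ turn P × ordT Bₖ ≡ t
  turning = T-unique Bₖ t (+ᵖ-Normal (X ^ᵖ P) (X+1 ^ᵖ (P + P))) (eval₀-turn {P} z<s)
    (trans (cong (λ C → oneᵖ +ᵖ (X+1 *ᵖ C)) Bₖ≡)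
      (T-turn pow (iterate T R k) ((X+1 ^ᵖ k) *ᵖ R) f t final f≡t+P (X+1*-X+1^* size)))
  chain = iterate-T-chain p (P + P) (turn P) (X+1^*[turn+1] pow)
  iter≡ : iterate T B (k + P) ≡ iterate T (turn P) p
  iter≡ = trans (iterate-+ T B k P) (cong (λ C → iterate T C p) (proj₁ turning))
  ord≡ : ordSum (k + P) B ≡ P + p
  ord≡ = begin
    ordSum (k + P) B                   ≡⟨ ordSum-+ k P B ⟩
    ordSum k B + (ordT Bₖ + ordSum p (T Bₖ)) ≡⟨ cong₂ (λ a b → a + (ordT Bₖ + b)) (trans (cong (ordSum k) B≡) (proj₂ pert)) (trans (cong (ordSum p) (proj₁ turning)) (proj₁ chain)) ⟩
    E + (ordT Bₖ + p)                  ≡⟨ cong (λ a → E + (a + p)) (proj₂ turning) ⟩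
    E + (t + p)                        ≡⟨ ℕ.+-assoc E t p ⟨
    (E + t) + p                        ≡⟨ cong (_+ p) P≡E+t ⟨
    P + p                              ∎

descent : ∀ {Q} → IsPow2 Q → ∀ n k → n + suc k ≡ Q + Q → suc k ≤ Q → Descent Q n k
descent two^zero n zero size _ rewrite ℕ.+-cancelʳ-≡ 1 n 1 size = descent-base
descent two^zero n (suc k) _ (s≤s ())
descent (two^suc {P} pow) n k size k<2P with suc k ℕ.≤? P
... | yes k<P = subst (λ m → Descent (P + P) m k) n≡
                  (descent-lower pow size₁ (descent pow n₁ k size₁ k<P))
  where
  n₁ = (P + P) ∸ suc k
  size₁ : n₁ + suc k ≡ P + P
  size₁ = ℕ.m∸n+n≡m (ℕ.≤-trans k<P (ℕ.m≤m+n P P))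
  n≡ : n₁ + (P + P) ≡ n
  n≡ = ℕ.+-cancelʳ-≡ (suc k) (n₁ + (P + P)) n (begin
    (n₁ + (P + P)) + suc k   ≡⟨ solve 3 (λ a P k → (a :+ (P :+ P)) :+ (con 1 :+ k) := (a :+ (con 1 :+ k)) :+ (P :+ P)) refl n₁ P k ⟩
    (n₁ + suc k) + (P + P)   ≡⟨ cong (_+ (P + P)) size₁ ⟩
    (P + P) + (P + P)        ≡⟨ size ⟨
    n + suc k                ∎)
... | no k≮P = subst₂ (Descent (P + P)) n≡ k≡
                 (descent-upper pow size₁ (descent pow n₁ k₁ size₁ k₁<P))
  where
  P≤k : P ≤ k
  P≤k = ℕ.≤-pred (ℕ.≰⇒> k≮P)
  k₁ = k ∸ P
  k≡ : k₁ + P ≡ k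
  k≡ = ℕ.m∸n+n≡m P≤k
  k₁<P : suc k₁ ≤ P
  k₁<P = ℕ.+-cancelʳ-≤ P (suc k₁) P (subst (λ m → suc m ≤ P + P) (sym k≡) k<2P)
  n₁ = (P + P) ∸ suc k₁
  size₁ : n₁ + suc k₁ ≡ P + P
  size₁ = ℕ.m∸n+n≡m (ℕ.≤-trans k₁<P (ℕ.m≤m+n P P))
  n≡ : n₁ + P ≡ n
  n≡ = ℕ.+-cancelʳ-≡ (suc k) (n₁ + P) n (begin
    (n₁ + P) + suc k          ≡⟨ cong (λ m → (n₁ + P) + suc m) k≡ ⟨
    (n₁ + P) + suc (k₁ + P)   ≡⟨ solve 3 (λ a P b → (a :+ P) :+ (con 1 :+ (b :+ P)) := (a :+ (con 1 :+ b)) :+ (P :+ P)) refl n₁ P k₁ ⟩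
    (n₁ + suc k₁) + (P + P)   ≡⟨ cong (_+ (P + P)) size₁ ⟩
    (P + P) + (P + P)         ≡⟨ size ⟨
    n + suc k                 ∎)

-- The Collatz sequence of Mⁿ

oddTerm-stays-one : ∀ A i d → oddTerm A i ≡ oneᵖ → oddTerm A (d + i) ≡ oneᵖ
oddTerm-stays-one A i zero eq = eq
oddTerm-stays-one A i (suc d) eq = cong (λ B → oddStep (evenStep B)) (oddTerm-stays-one A i d eq)

M≢1+[X²+X]^ : ∀ {f} → 2 ≤ f → M ≢ oneᵖ +ᵖ (X²+X ^ᵖ f)
M≢1+[X²+X]^ {f} 2≤f eq = ℕ.<⇒≢ 2≤f (sym (begin
  f                                      ≡⟨ ordX-X^* f (^ᵖ-Normal X+1 f) (eval₀-X+1^ f) ⟨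
  ordX ((X ^ᵖ f) *ᵖ (X+1 ^ᵖ f))          ≡⟨ cong ordX (*ᵖ-^ X X+1 f) ⟨
  ordX (X²+X ^ᵖ f)                       ≡⟨ cong ordX (1+[1+p]≡p (^ᵖ-Normal X²+X f)) ⟨
  ordX (oneᵖ +ᵖ (oneᵖ +ᵖ (X²+X ^ᵖ f)))   ≡⟨ cong (λ p → ordX (oneᵖ +ᵖ p)) eq ⟨
  ordX (oneᵖ +ᵖ M)                       ∎))

Descent⇒HasLength : ∀ {Q n k} → Descent Q n k → HasLength (M ^ᵖ n) (suc (suc k))
Descent⇒HasLength {Q} {n} {k} d = reaches-one , avoids-one
  where
  open Descent d renaming (exponent to f)
  S^n = X+1 ^ᵖ n
  Bₖ = iterate T S^n k
  oddTerm≡φ : ∀ i → oddTerm (M ^ᵖ n) i ≡ φ (iterate T S^n i)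
  oddTerm≡φ = subst (λ A → ∀ i → oddTerm A i ≡ φ (iterate T S^n i)) (φ-^ᵖ X+1 n)
                (oddTerm-φ (eval₀-X+1^ n))
  TBₖ≡1 : T Bₖ ≡ oneᵖ
  TBₖ≡1 = proj₁ (T-unique Bₖ f one refl (begin
    oneᵖ +ᵖ (X+1 *ᵖ Bₖ)             ≡⟨ cong (oneᵖ +ᵖ_) final ⟩
    oneᵖ +ᵖ (oneᵖ +ᵖ (X ^ᵖ f))      ≡⟨ 1+[1+p]≡p (^ᵖ-Normal X f) ⟩
    X ^ᵖ f                          ≡⟨ *ᵖ-identityʳ (^ᵖ-Normal X f) ⟨
    (X ^ᵖ f) *ᵖ oneᵖ                ∎))
  reaches-one : oddTerm (M ^ᵖ n) (suc k) ≡ oneᵖ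
  reaches-one = trans (oddTerm≡φ (suc k)) (cong φ (trans (iterate-suc T S^n k) TBₖ≡1))
  2≤f : 2 ≤ f
  2≤f = ℕ.<-≤-trans (s≤s (ℕ.<-≤-trans z<s ordSum<Q)) (Descent-exponent>Q d)
  avoids-one : ∀ i → i < suc k → ¬ (oddTerm (M ^ᵖ n) i ≡ oneᵖ)
  avoids-one i (s≤s i≤k) one-at-i = M≢1+[X²+X]^ 2≤f (begin
    M                               ≡⟨ *ᵖ-identityʳ (cons true (cons true one)) ⟨
    M *ᵖ oneᵖ                       ≡⟨ cong (M *ᵖ_) φBₖ≡1 ⟨
    φ X+1 *ᵖ φ Bₖ                   ≡⟨ φ-*ᵖ X+1 Bₖ ⟨
    φ (X+1 *ᵖ Bₖ)                   ≡⟨ cong φ final ⟩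
    φ (oneᵖ +ᵖ (X ^ᵖ f))            ≡⟨ trans (φ-+ᵖ oneᵖ (X ^ᵖ f)) (cong (oneᵖ +ᵖ_) (φ-^ᵖ X f)) ⟩
    oneᵖ +ᵖ (X²+X ^ᵖ f)             ∎)
    where
    φBₖ≡1 : φ Bₖ ≡ oneᵖ
    φBₖ≡1 = trans (sym (oddTerm≡φ k))
      (subst (λ m → oddTerm (M ^ᵖ n) m ≡ oneᵖ) (ℕ.m∸n+n≡m i≤k) (oddTerm-stays-one (M ^ᵖ n) i (k ∸ i) one-at-i))

HasLength-M^[2Q∸m] : ∀ {Q} → IsPow2 Q → ∀ m → 0 < m → m ≤ Q → HasLength (M ^ᵖ ((Q + Q) ∸ m)) (m + 1)
HasLength-M^[2Q∸m] {Q} pow (suc k) _ m≤Q =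
  subst (HasLength (M ^ᵖ ((Q + Q) ∸ suc k))) (ℕ.+-comm 1 (suc k))
    (Descent⇒HasLength (descent pow ((Q + Q) ∸ suc k) k (ℕ.m∸n+n≡m (ℕ.≤-trans m≤Q (ℕ.m≤m+n Q Q))) m≤Q))

proposition3p8 : (r j : ℕ) → 1 ≤ r → j ≤ 2 ^ (r ∸ 1) ∸ 1 →
    (¬ (j ≡ 0) → HasLength (M ^ᵖ (2 ^ r ∸ j)) (j + 1))
    × (j ≡ 0 → HasLength (M ^ᵖ (2 ^ r ∸ j)) (2 ^ r + 1))
proposition3p8 (suc b) j (s≤s z≤n) j≤ = j≢0-case , j≡0-case
  where
  Q = 2 ^ b
  j≢0-case : ¬ (j ≡ 0) → HasLength (M ^ᵖ (2 ^ suc b ∸ j)) (j + 1)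
  j≢0-case j≢0 = subst (λ N → HasLength (M ^ᵖ (N ∸ j)) (j + 1)) (cong (Q +_) (sym (ℕ.+-identityʳ Q)))
    (HasLength-M^[2Q∸m] (IsPow2-2^ b) j (ℕ.n≢0⇒n>0 j≢0) (ℕ.≤-trans j≤ (ℕ.m∸n≤m Q 1)))
  j≡0-case : j ≡ 0 → HasLength (M ^ᵖ (2 ^ suc b ∸ j)) (2 ^ suc b + 1)
  j≡0-case refl = subst (λ N → HasLength (M ^ᵖ N) (2 ^ suc b + 1)) (ℕ.m+n∸n≡m (2 ^ suc b) (2 ^ suc b))
    (HasLength-M^[2Q∸m] (IsPow2-2^ (suc b)) (2 ^ suc b) (IsPow2-positive (IsPow2-2^ (suc b))) ℕ.≤-refl)
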